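{- Let $N\ge1$ be an integer and $b_1,\dots,b_N\in\mathbb{Q}$ with $b_N\neq0$. Let \[R(x_1,\dots,x_N):=(1+x_1)^{b_1}(1+x_1+x_2)^{b_2}\cdots(1+x_1+\dots+x_N)^{b_N}.\] For $k=1,\dots,N$ let $B(k):=-(b_k+\dots+b_N)$ and \[u^k:=\left(\tfrac{B(k)}{N-k+1},\tfrac{B(k)+1}{N-k+1},\dots,\tfrac{B(k)+N-k}{N-k+1}\right);\] for $k=1,\dots,N-1$ let \[v^k:=\left(\tfrac{B(k)}{N-k},\tfrac{B(k)+1}{N-k},\dots,\tfrac{B(k)+N-k-1}{N-k}\right),\] and let $v^N:=(1,\dots,1)$ consist of exactly $N-1$ ones. Let $u:=(u^1,\dots,u^N)$ (of length $M:=N(N+1)/2$) and $v:=(v^1,\dots,v^N)$ (of length $M-1$). Then \[\operatorname{Diag}(R(x_1,\dots,x_N))={}_MF_{M-1}(u;v;(-N)^Nt).\]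
   Context: All power series have coefficients in $\mathbb{Q}$. For $a\in\mathbb{Q}$ and a power series $L$ with zero constant term, $(1+L)^a:=\sum_{j\ge0}\binom{a}{j}L^j$ with $\binom{a}{j}=a(a-1)\cdots(a-j+1)/j!$. For $g=\sum g_{i_1,\dots,i_N}x_1^{i_1}\cdots x_N^{i_N}$, $\operatorname{Diag}(g):=\sum_{j\ge0}g_{j,\dots,j}t^j$. For tuples $u=(a_1,\dots,a_p)$, $v=(b_1,\dots,b_q)$, ${}_pF_q(u;v;t):=\sum_{j\ge0}\frac{(a_1)_j\cdots(a_p)_j}{(b_1)_j\cdots(b_q)_j}\frac{t^j}{j!}$ with $(x)_j=x(x+1)\cdots(x+j-1)$, defined when no $b_i+j$ ($j\in\mathbb{N}$) vanishes. -}

module Defs where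

open import Data.Nat as ℕ using (ℕ; zero; suc; _∸_; _≡ᵇ_; _<ᵇ_)
open import Data.Nat using (_!)
open import Data.Integer using (+_)
open import Data.Rational using (ℚ; 0ℚ; 1ℚ; _+_; _*_; _-_; -_; _/_; 1/_; ≢-nonZero)
open import Data.Rational.Properties using (_≟_)
open import Data.Fin as Fin using (Fin; toℕ)
open import Data.Vec as Vec using (Vec; []; _∷_; replicate; tabulate; zipWith; toList)
open import Data.Vec.Properties using (≡-dec)
open import Data.List as List using (List; []; _∷_; map; concatMap; upTo; allFin; foldr; applyUpTo)
open import Data.Bool using (if_then_else_)
open import Relation.Nullary using (yes; no; does)

ℕ→ℚ : ℕ → ℚ
ℕ→ℚ m = (+ m) / 1

-- total inverse (inv 0 = 0); only ever applied to nonzero arguments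
-- in the statement (guaranteed by the hypotheses)
inv : ℚ → ℚ
inv q with q ≟ 0ℚ
... | yes _ = 0ℚ
... | no q≢0 = 1/_ q {{≢-nonZero q≢0}}

sumℚ : List ℚ → ℚ
sumℚ = foldr _+_ 0ℚ

prodℚ : List ℚ → ℚ
prodℚ = foldr _*_ 1ℚ

_^ℚ_ : ℚ → ℕ → ℚ
q ^ℚ zero = 1ℚ
q ^ℚ suc j = q * (q ^ℚ j)

poch : ℚ → ℕ → ℚ
poch x j = prodℚ (applyUpTo (λ i → x + ℕ→ℚ i) j)

binomℚ : ℚ → ℕ → ℚ
binomℚ a j = prodℚ (applyUpTo (λ i → a - ℕ→ℚ i) j) * inv (ℕ→ℚ (j !))

-- Formal power series in n variables over ℚ: coefficient functions
-- on multi-indices (i₁,…,iₙ).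

PS : ℕ → Set
PS n = Vec ℕ n → ℚ

below : ∀ {n} → Vec ℕ n → List (Vec ℕ n)
below [] = [] ∷ []
below (a ∷ α) = concatMap (λ i → map (i ∷_) (below α)) (upTo (suc a))

deg : ∀ {n} → Vec ℕ n → ℕ
deg α = Vec.foldr _ ℕ._+_ 0 α

mono : ∀ {n} → Vec ℕ n → PS n
mono γ α = if does (≡-dec ℕ._≟_ α γ) then 1ℚ else 0ℚ

onePS : ∀ {n} → PS n
onePS {n} = mono (replicate n 0)

var : ∀ {n} → Fin n → PS n
var {n} i = mono (tabulate (λ j → if does (i Fin.≟ j) then 1 else 0))

_⊕_ : ∀ {n} → PS n → PS n → PS n
(f ⊕ g) α = f α + g α

_⊛_ : ∀ {n} → PS n → PS n → PS n
(f ⊛ g) α = sumℚ (map (λ β → f β * g (zipWith _∸_ α β)) (below α))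

powPS : ∀ {n} → PS n → ℕ → PS n
powPS f zero = onePS
powPS f (suc j) = f ⊛ powPS f j

-- (1+L)^a := Σ_{j≥0} binom(a,j) L^j, for L with zero constant term.
-- Since L has zero constant term, L^j has no monomials of total degree
-- < j, so the coefficient of x^α only receives contributions from
-- j ≤ |α|; the formal infinite sum is therefore this finite sum.
onePlusPow : ∀ {n} → PS n → ℚ → PS n
onePlusPow L a α = sumℚ (map (λ j → binomℚ a j * powPS L j α) (upTo (suc (deg α))))

-- x₁ + … + x_k  (k counts variables, 1-based)
linSum : ∀ {n} → ℕ → PS n
linSum {n} k α = sumℚ (map (λ i → if toℕ i <ᵇ k then var i α else 0ℚ) (allFin n))

-- R(x₁,…,x_N) = ∏_{k=1}^N (1 + x₁ + … + x_k)^{b_k}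
-- (index k : Fin N corresponds to the paper's k = toℕ k + 1)
R : ∀ {N} → (Fin N → ℚ) → PS N
R {N} b = foldr _⊛_ onePS (map (λ k → onePlusPow (linSum (suc (toℕ k))) (b k)) (allFin N))

-- Diag(g) as the coefficient sequence of t^j
Diag : ∀ {N} → PS N → ℕ → ℚ
Diag {N} g j = g (replicate N j)

-- pFq(u;v;z) as the coefficient sequence of t^j (z a fixed rational)
hypF : List ℚ → List ℚ → ℚ → ℕ → ℚ
hypF us vs z j =
  prodℚ (map (λ a → poch a j) us) * inv (prodℚ (map (λ c → poch c j) vs) * ℕ→ℚ (j !)) * (z ^ℚ j)

-- The parameters u, v (paper's k = toℕ k + 1, so N - k + 1 = N - toℕ k)

Bk : ∀ {N} → (Fin N → ℚ) → Fin N → ℚ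
Bk {N} b k = - sumℚ (map (λ i → if toℕ k ℕ.≤ᵇ toℕ i then b i else 0ℚ) (allFin N))

uPart : ∀ {N} → (Fin N → ℚ) → Fin N → List ℚ
uPart {N} b k = applyUpTo (λ m → (Bk b k + ℕ→ℚ m) * inv (ℕ→ℚ (N ∸ toℕ k))) (N ∸ toℕ k)

vPart : ∀ {N} → (Fin N → ℚ) → Fin N → List ℚ
vPart {N} b k =
  if suc (toℕ k) ≡ᵇ N
  then List.replicate (N ∸ 1) 1ℚ
  else applyUpTo (λ m → (Bk b k + ℕ→ℚ m) * inv (ℕ→ℚ (N ∸ suc (toℕ k)))) (N ∸ suc (toℕ k))

uParams : ∀ {N} → (Fin N → ℚ) → List ℚ
uParams {N} b = concatMap (uPart b) (allFin N)

vParams : ∀ {N} → (Fin N → ℚ) → List ℚ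
vParams {N} b = concatMap (vPart b) (allFin N)

-- Only the last factor (1 + x₁ + ⋯ + x_N)^{b_N} involves x_N, and its x_N^j-coefficient is
-- binom(b_N, j) (1 + x₁ + ⋯ + x_{N−1})^{b_N − j}; by the exponent law (Vandermonde) this merges
-- with the factor of exponent b_{N−1}.  Iterating, Diag(R) has t^j-coefficient
-- ∏ₖ binom(−B(k) − (N − k) j, j).  Since binom(−B − m j, j) j! = (−1)^j (B + m j)_j and, by Gauss's
-- multiplication formula, (B)_{m j} = m^{m j} ∏_{i<m} ((B + i)/m)_j, the k-th factor is the ratio
-- of the u^k-block to the v^k-block of Pochhammer products, and the powers m^{m j} telescope
-- to ((−N)^N)^j.

{-# OPTIONS --safe #-}
module Submission where

open import Defs
open import Algebra.Bundles using (CommutativeSemigroup)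
open import Algebra.Structures using (IsCommutativeMonoid)
import Algebra.Properties.CommutativeSemigroup as CommutativeSemigroupProperties
open import Data.Bool using (Bool; true; false; T; if_then_else_)
open import Data.Empty using (⊥-elim)
open import Data.Fin as Fin using (Fin; toℕ; fromℕ; inject₁)
import Data.Fin.Properties as FinP
import Data.Integer as ℤ
import Data.Integer.Properties as ℤP
open import Data.List as L using (List; []; _∷_; _++_; map; concatMap; upTo; applyUpTo)
import Data.List.Properties as LP
open import Data.List.Relation.Unary.All using (All; []; _∷_)
open import Data.Nat as ℕ using (ℕ; zero; suc; _∸_; _<_; _≤_; z≤n; s≤s; _!)
open import Data.Nat.Combinatorics using (_C_; nCk≡n!/k![n-k]!; k![n∸k]!∣n!; k>n⇒nCk≡0; nCk+nC[k+1]≡[n+1]C[k+1])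
import Data.Nat.Coprimality as Coprimality
open import Data.Nat.DivMod using (m/n*n≡m)
import Data.Nat.Properties as ℕP
open import Data.Product using (_,_)
open import Data.Rational using (ℚ; 0ℚ; 1ℚ; _+_; _*_; _-_; -_; mkℚ; ↥_; ≢-nonZero)
import Data.Rational.Properties as QP
open import Data.Rational.Solver using (module +-*-Solver)
open +-*-Solver using (solve; _:=_; _:+_; _:*_; :-_; _:-_; con)
open import Data.Vec as V using (Vec; []; _∷_; _∷ʳ_; zipWith)
import Data.Vec.Properties as VP
open import Function using (_∘_)
open import Relation.Binary.PropositionalEquality
open import Relation.Nullary using (Dec; yes; no; does)
open import Relation.Nullary.Decidable using (dec-true; dec-false)

ℕ→ℚ≡mkℚ : ∀ m → ℕ→ℚ m ≡ mkℚ (ℤ.+ m) 0 (Coprimality.sym (Coprimality.1-coprimeTo m))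
ℕ→ℚ≡mkℚ m = QP.normalize-coprime (Coprimality.sym (Coprimality.1-coprimeTo m))

ℕ→ℚ-+ : ∀ m n → ℕ→ℚ (m ℕ.+ n) ≡ ℕ→ℚ m + ℕ→ℚ n
ℕ→ℚ-+ m n rewrite ℕ→ℚ≡mkℚ m | ℕ→ℚ≡mkℚ n =
  QP./-cong {p₁ = ℤ.+ (m ℕ.+ n)} {q₁ = 1} {p₂ = ℤ.+ m ℤ.* ℤ.+ 1 ℤ.+ ℤ.+ n ℤ.* ℤ.+ 1} {q₂ = 1}
    (sym (cong₂ ℤ._+_ (ℤP.*-identityʳ (ℤ.+ m)) (ℤP.*-identityʳ (ℤ.+ n)))) refl

ℕ→ℚ-* : ∀ m n → ℕ→ℚ (m ℕ.* n) ≡ ℕ→ℚ m * ℕ→ℚ n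
ℕ→ℚ-* m n rewrite ℕ→ℚ≡mkℚ m | ℕ→ℚ≡mkℚ n =
  QP./-cong {p₁ = ℤ.+ (m ℕ.* n)} {q₁ = 1} {p₂ = ℤ.+ m ℤ.* ℤ.+ n} {q₂ = 1} (ℤP.pos-* m n) refl

ℕ→ℚ-suc : ∀ m → ℕ→ℚ (suc m) ≡ 1ℚ + ℕ→ℚ m
ℕ→ℚ-suc = ℕ→ℚ-+ 1

ℕ→ℚ-suc≢0 : ∀ m → ℕ→ℚ (suc m) ≢ 0ℚ
ℕ→ℚ-suc≢0 m eq with cong ↥_ (trans (sym (ℕ→ℚ≡mkℚ (suc m))) eq)
... | ()

ℕ→ℚ-!≢0 : ∀ k → ℕ→ℚ (k !) ≢ 0ℚ
ℕ→ℚ-!≢0 k with k ! | ℕP.1≤n! k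
... | suc m | _ = ℕ→ℚ-suc≢0 m

*-inv : ∀ q → q ≢ 0ℚ → q * inv q ≡ 1ℚ
*-inv q q≢0 with q QP.≟ 0ℚ
... | yes q≡0 = ⊥-elim (q≢0 q≡0)
... | no q≢0′ = QP.*-inverseʳ q {{≢-nonZero q≢0′}}

*-inv-cancelʳ : ∀ x {y} → y ≢ 0ℚ → (x * y) * inv y ≡ x
*-inv-cancelʳ x {y} y≢0 = begin
  (x * y) * inv y ≡⟨ QP.*-assoc x y (inv y) ⟩
  x * (y * inv y) ≡⟨ cong (x *_) (*-inv y y≢0) ⟩
  x * 1ℚ          ≡⟨ QP.*-identityʳ x ⟩
  x               ∎
  where open ≡-Reasoning

*-cancelʳ : ∀ {x z} y → y ≢ 0ℚ → x * y ≡ z * y → x ≡ z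
*-cancelʳ {x} {z} y y≢0 eq = begin
  x               ≡⟨ *-inv-cancelʳ x y≢0 ⟨
  (x * y) * inv y ≡⟨ cong (_* inv y) eq ⟩
  (z * y) * inv y ≡⟨ *-inv-cancelʳ z y≢0 ⟩
  z               ∎
  where open ≡-Reasoning

*-≢0 : ∀ {x y} → x ≢ 0ℚ → y ≢ 0ℚ → x * y ≢ 0ℚ
*-≢0 {x} {y} x≢0 y≢0 eq = x≢0 (*-cancelʳ y y≢0 (trans eq (sym (QP.*-zeroˡ y))))

≡*⇒*inv≡ : ∀ {x z} y → y ≢ 0ℚ → x ≡ z * y → x * inv y ≡ z
≡*⇒*inv≡ {x} {z} y y≢0 eq = trans (cong (_* inv y) eq) (*-inv-cancelʳ z y≢0)

module CommutativeFolds {A : Set} {_∙_ : A → A → A} {ε : A}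
                        (isCM : IsCommutativeMonoid _≡_ _∙_ ε) where

  open IsCommutativeMonoid isCM using (assoc; identityˡ; identityʳ; isCommutativeSemigroup)

  private
    commutativeSemigroup : CommutativeSemigroup _ _
    commutativeSemigroup = record { isCommutativeSemigroup = isCommutativeSemigroup }

  open CommutativeSemigroupProperties commutativeSemigroup using (interchange)
  open ≡-Reasoning

  fold : List A → A
  fold = L.foldr _∙_ ε

  fold-++ : ∀ xs ys → fold (xs ++ ys) ≡ fold xs ∙ fold ys
  fold-++ []       ys = sym (identityˡ (fold ys))
  fold-++ (x ∷ xs) ys = trans (cong (x ∙_) (fold-++ xs ys)) (sym (assoc x (fold xs) (fold ys)))

  fold-map-cong : ∀ {B : Set} (xs : List B) {f g : B → A} → (∀ x → f x ≡ g x) →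
                  fold (map f xs) ≡ fold (map g xs)
  fold-map-cong xs eq = cong fold (LP.map-cong eq xs)

  fold-map-ε : ∀ {B : Set} (xs : List B) {f : B → A} → (∀ x → f x ≡ ε) → fold (map f xs) ≡ ε
  fold-map-ε []       eq = refl
  fold-map-ε (x ∷ xs) eq = trans (cong₂ _∙_ (eq x) (fold-map-ε xs eq)) (identityˡ ε)

  fold-map-concatMap : ∀ {B C : Set} (f : C → A) (g : B → List C) xs →
                       fold (map f (concatMap g xs)) ≡ fold (map (λ x → fold (map f (g x))) xs)
  fold-map-concatMap f g []       = refl
  fold-map-concatMap f g (x ∷ xs) = begin
    fold (map f (g x ++ concatMap g xs))
      ≡⟨ cong fold (LP.map-++ f (g x) (concatMap g xs)) ⟩
    fold (map f (g x) ++ map f (concatMap g xs))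
      ≡⟨ fold-++ (map f (g x)) (map f (concatMap g xs)) ⟩
    fold (map f (g x)) ∙ fold (map f (concatMap g xs))
      ≡⟨ cong (fold (map f (g x)) ∙_) (fold-map-concatMap f g xs) ⟩
    fold (map (λ x → fold (map f (g x))) (x ∷ xs)) ∎

  range : ℕ → (ℕ → A) → A
  range zero    f = ε
  range (suc n) f = f 0 ∙ range n (f ∘ suc)

  fold-applyUpTo : ∀ n f → fold (applyUpTo f n) ≡ range n f
  fold-applyUpTo zero    f = refl
  fold-applyUpTo (suc n) f = cong (f 0 ∙_) (fold-applyUpTo n (f ∘ suc))

  fold-map-applyUpTo : ∀ {B : Set} n (g : ℕ → B) (f : B → A) → fold (map f (applyUpTo g n)) ≡ range n (f ∘ g)
  fold-map-applyUpTo n g f = trans (cong fold (LP.map-applyUpTo g f n)) (fold-applyUpTo n (f ∘ g))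

  range-cong-< : ∀ n {f g : ℕ → A} → (∀ t → t < n → f t ≡ g t) → range n f ≡ range n g
  range-cong-< zero    eq = refl
  range-cong-< (suc n) eq = cong₂ _∙_ (eq 0 (s≤s z≤n)) (range-cong-< n (λ t t<n → eq (suc t) (s≤s t<n)))

  range-cong : ∀ n {f g : ℕ → A} → (∀ t → f t ≡ g t) → range n f ≡ range n g
  range-cong n eq = range-cong-< n (λ t _ → eq t)

  range-ε : ∀ n → range n (λ _ → ε) ≡ ε
  range-ε zero    = refl
  range-ε (suc n) = trans (identityˡ _) (range-ε n)

  range-ε-< : ∀ n {f : ℕ → A} → (∀ t → t < n → f t ≡ ε) → range n f ≡ ε
  range-ε-< n eq = trans (range-cong-< n eq) (range-ε n)

  range-distrib : ∀ n (f g : ℕ → A) → range n (λ t → f t ∙ g t) ≡ range n f ∙ range n g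
  range-distrib zero    f g = sym (identityˡ ε)
  range-distrib (suc n) f g = trans (cong ((f 0 ∙ g 0) ∙_) (range-distrib n (f ∘ suc) (g ∘ suc)))
                                    (interchange (f 0) (g 0) _ _)

  range-split : ∀ a m (f : ℕ → A) → range (a ℕ.+ m) f ≡ range a f ∙ range m (λ i → f (a ℕ.+ i))
  range-split zero    m f = sym (identityˡ _)
  range-split (suc a) m f = trans (cong (f 0 ∙_) (range-split a m (f ∘ suc))) (sym (assoc (f 0) _ _))

  range-snoc : ∀ n (f : ℕ → A) → range (suc n) f ≡ range n f ∙ f n
  range-snoc n f = begin
    range (suc n) f            ≡⟨ cong (λ m → range m f) (ℕP.+-comm 1 n) ⟩
    range (n ℕ.+ 1) f          ≡⟨ range-split n 1 f ⟩
    range n f ∙ (f (n ℕ.+ 0) ∙ ε) ≡⟨ cong (range n f ∙_) (trans (identityʳ _) (cong f (ℕP.+-identityʳ n))) ⟩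
    range n f ∙ f n            ∎

  range-swap : ∀ m n (F : ℕ → ℕ → A) → range m (λ i → range n (F i)) ≡ range n (λ t → range m (λ i → F i t))
  range-swap zero    n F = sym (range-ε n)
  range-swap (suc m) n F = trans (cong (range n (F 0) ∙_) (range-swap m n (F ∘ suc)))
                                 (sym (range-distrib n (F 0) _))

  range-first : ∀ n (f : ℕ → A) → (∀ t → f (suc t) ≡ ε) → range (suc n) f ≡ f 0
  range-first n f eq = trans (cong (f 0 ∙_) (range-ε-< n (λ t _ → eq t))) (identityʳ (f 0))

  range-last : ∀ n (f : ℕ → A) → (∀ t → t < n → f t ≡ ε) → range (suc n) f ≡ f n
  range-last n f eq = trans (range-snoc n f) (trans (cong (_∙ f n) (range-ε-< n eq)) (identityˡ (f n)))

  tabulate-cong : ∀ n {f g : Fin n → A} → (∀ i → f i ≡ g i) → fold (L.tabulate f) ≡ fold (L.tabulate g)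
  tabulate-cong n eq = cong fold (LP.tabulate-cong eq)

  tabulate-distrib : ∀ n (f g : Fin n → A) → fold (L.tabulate (λ i → f i ∙ g i)) ≡ fold (L.tabulate f) ∙ fold (L.tabulate g)
  tabulate-distrib zero    f g = sym (identityˡ ε)
  tabulate-distrib (suc n) f g = trans (cong ((f Fin.zero ∙ g Fin.zero) ∙_) (tabulate-distrib n (f ∘ Fin.suc) (g ∘ Fin.suc)))
                                       (interchange (f Fin.zero) (g Fin.zero) _ _)

  tabulate-ε : ∀ n → fold (L.tabulate {n = n} (λ _ → ε)) ≡ ε
  tabulate-ε zero    = refl
  tabulate-ε (suc n) = trans (identityˡ _) (tabulate-ε n)

  tabulate-snoc : ∀ n (f : Fin (suc n) → A) → fold (L.tabulate f) ≡ fold (L.tabulate (f ∘ inject₁)) ∙ f (fromℕ n)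
  tabulate-snoc zero    f = trans (identityʳ (f Fin.zero)) (sym (identityˡ (f Fin.zero)))
  tabulate-snoc (suc n) f = trans (cong (f Fin.zero ∙_) (tabulate-snoc n (f ∘ Fin.suc))) (sym (assoc (f Fin.zero) _ _))

module Σ = CommutativeFolds QP.+-0-isCommutativeMonoid
module Π = CommutativeFolds QP.*-1-isCommutativeMonoid

Σ< : ℕ → (ℕ → ℚ) → ℚ
Σ< = Σ.range

Π< : ℕ → (ℕ → ℚ) → ℚ
Π< = Π.range

Σ<-*ˡ : ∀ n c (f : ℕ → ℚ) → Σ< n (λ t → c * f t) ≡ c * Σ< n f
Σ<-*ˡ zero    c f = sym (QP.*-zeroʳ c)
Σ<-*ˡ (suc n) c f = trans (cong (c * f 0 +_) (Σ<-*ˡ n c (f ∘ suc))) (sym (QP.*-distribˡ-+ c (f 0) _))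

Σ<-*ʳ : ∀ n c (f : ℕ → ℚ) → Σ< n (λ t → f t * c) ≡ Σ< n f * c
Σ<-*ʳ n c f = trans (Σ.range-cong n (λ t → QP.*-comm (f t) c)) (trans (Σ<-*ˡ n c f) (QP.*-comm c _))

Π<-const : ∀ m c → Π< m (λ _ → c) ≡ c ^ℚ m
Π<-const zero    c = refl
Π<-const (suc m) c = cong (c *_) (Π<-const m c)

Π<-≢0 : ∀ m (f : ℕ → ℚ) → (∀ i → f i ≢ 0ℚ) → Π< m f ≢ 0ℚ
Π<-≢0 zero    f nz ()
Π<-≢0 (suc m) f nz = *-≢0 (nz 0) (Π<-≢0 m (f ∘ suc) (nz ∘ suc))

poch≡Π< : ∀ x j → poch x j ≡ Π< j (λ l → x + ℕ→ℚ l)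
poch≡Π< x j = Π.fold-applyUpTo j (λ l → x + ℕ→ℚ l)

Σ-map-*ˡ : ∀ {B : Set} (xs : List B) c (f : B → ℚ) → sumℚ (map (λ x → c * f x) xs) ≡ c * sumℚ (map f xs)
Σ-map-*ˡ []       c f = sym (QP.*-zeroʳ c)
Σ-map-*ˡ (x ∷ xs) c f = trans (cong (c * f x +_) (Σ-map-*ˡ xs c f)) (sym (QP.*-distribˡ-+ c (f x) _))

-- Formal power series, sliced along the last variable

slice : ∀ {n} → PS (suc n) → ℕ → PS n
slice f a α = f (α ∷ʳ a)

slice-ext : ∀ {n} {f g : PS (suc n)} → (∀ a → slice f a ≗ slice g a) → f ≗ g
slice-ext eq v with V.initLast v
... | α , a , refl = eq a α

_·_ : ∀ {n} → ℚ → PS n → PS n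
(c · f) α = c * f α

sum-below-∷ : ∀ {n} c (α : Vec ℕ n) (F : Vec ℕ (suc n) → ℚ) →
              sumℚ (map F (below (c ∷ α))) ≡ Σ< (suc c) (λ i → sumℚ (map (F ∘ (i ∷_)) (below α)))
sum-below-∷ c α F = begin
  sumℚ (map F (concatMap (λ i → map (i ∷_) (below α)) (upTo (suc c))))
    ≡⟨ Σ.fold-map-concatMap F (λ i → map (i ∷_) (below α)) (upTo (suc c)) ⟩
  sumℚ (map (λ i → sumℚ (map F (map (i ∷_) (below α)))) (upTo (suc c)))
    ≡⟨ Σ.fold-map-applyUpTo (suc c) (λ i → i) (λ i → sumℚ (map F (map (i ∷_) (below α)))) ⟩
  Σ< (suc c) (λ i → sumℚ (map F (map (i ∷_) (below α))))
    ≡⟨ Σ.range-cong (suc c) (λ i → cong sumℚ (sym (LP.map-∘ {g = F} {f = i ∷_} (below α)))) ⟩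
  Σ< (suc c) (λ i → sumℚ (map (F ∘ (i ∷_)) (below α))) ∎
  where open ≡-Reasoning

sum-below-∷ʳ : ∀ {n} (α : Vec ℕ n) a (F : Vec ℕ (suc n) → ℚ) →
               sumℚ (map F (below (α ∷ʳ a))) ≡ Σ< (suc a) (λ t → sumℚ (map (λ β → F (β ∷ʳ t)) (below α)))
sum-below-∷ʳ []      a F = sum-below-∷ a [] F
sum-below-∷ʳ (c ∷ α) a F = begin
  sumℚ (map F (below (c ∷ (α ∷ʳ a))))
    ≡⟨ sum-below-∷ c (α ∷ʳ a) F ⟩
  Σ< (suc c) (λ i → sumℚ (map (F ∘ (i ∷_)) (below (α ∷ʳ a))))
    ≡⟨ Σ.range-cong (suc c) (λ i → sum-below-∷ʳ α a (F ∘ (i ∷_))) ⟩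
  Σ< (suc c) (λ i → Σ< (suc a) (λ t → sumℚ (map (λ β → F (i ∷ (β ∷ʳ t))) (below α))))
    ≡⟨ Σ.range-swap (suc c) (suc a) (λ i t → sumℚ (map (λ β → F (i ∷ (β ∷ʳ t))) (below α))) ⟩
  Σ< (suc a) (λ t → Σ< (suc c) (λ i → sumℚ (map (λ β → F (i ∷ (β ∷ʳ t))) (below α))))
    ≡⟨ Σ.range-cong (suc a) (λ t → sym (sum-below-∷ c α (λ β → F (β ∷ʳ t)))) ⟩
  Σ< (suc a) (λ t → sumℚ (map (λ β → F (β ∷ʳ t)) (below (c ∷ α)))) ∎
  where open ≡-Reasoning

⊛-slice : ∀ {n} (f g : PS (suc n)) a (α : Vec ℕ n) →
          (f ⊛ g) (α ∷ʳ a) ≡ Σ< (suc a) (λ t → (slice f t ⊛ slice g (a ∸ t)) α)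
⊛-slice f g a α = trans (sum-below-∷ʳ α a (λ β → f β * g (zipWith _∸_ (α ∷ʳ a) β)))
  (Σ.range-cong (suc a) (λ t → Σ.fold-map-cong (below α) (λ β →
    cong (λ v → f (β ∷ʳ t) * g v) (zipWith-∷ʳ t α β))))
  where
  zipWith-∷ʳ : ∀ {m} t (α β : Vec ℕ m) → zipWith _∸_ (α ∷ʳ a) (β ∷ʳ t) ≡ zipWith _∸_ α β ∷ʳ (a ∸ t)
  zipWith-∷ʳ t []      []      = refl
  zipWith-∷ʳ t (x ∷ α) (y ∷ β) = cong (x ∸ y ∷_) (zipWith-∷ʳ t α β)

⊛-cong : ∀ {n} {f f′ g g′ : PS n} → f ≗ f′ → g ≗ g′ → (f ⊛ g) ≗ (f′ ⊛ g′)
⊛-cong {f = f} {f′} {g} {g′} ef eg α =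
  Σ.fold-map-cong (below α) {λ β → f β * g (zipWith _∸_ α β)} {λ β → f′ β * g′ (zipWith _∸_ α β)}
    (λ β → cong₂ _*_ (ef β) (eg (zipWith _∸_ α β)))

⊛-congˡ : ∀ {n} {f f′ : PS n} (g : PS n) → f ≗ f′ → (f ⊛ g) ≗ (f′ ⊛ g)
⊛-congˡ {f = f} {f′} g ef = ⊛-cong {f = f} {f′} {g} {g} ef (λ _ → refl)

⊛-congʳ : ∀ {n} (f : PS n) {g g′ : PS n} → g ≗ g′ → (f ⊛ g) ≗ (f ⊛ g′)
⊛-congʳ f {g} {g′} = ⊛-cong {f = f} {f} {g} {g′} (λ _ → refl)

⊛-scaleˡ : ∀ {n} c (f g : PS n) → ((c · f) ⊛ g) ≗ (c · (f ⊛ g))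
⊛-scaleˡ c f g α = trans (Σ.fold-map-cong (below α) (λ β → QP.*-assoc c (f β) (g (zipWith _∸_ α β)))) (Σ-map-*ˡ (below α) c _)

⊛-scaleʳ : ∀ {n} c (f g : PS n) → (f ⊛ (c · g)) ≗ (c · (f ⊛ g))
⊛-scaleʳ c f g α = trans (Σ.fold-map-cong (below α) (λ β → solve 3 (λ x y z → x :* (y :* z) := y :* (x :* z)) refl (f β) c (g (zipWith _∸_ α β))))
                         (Σ-map-*ˡ (below α) c _)

⊛-zeroˡ : ∀ {n} {f : PS n} (g : PS n) → f ≗ (λ _ → 0ℚ) → ∀ α → (f ⊛ g) α ≡ 0ℚ
⊛-zeroˡ g eq α = Σ.fold-map-ε (below α) (λ β → trans (cong (_* g (zipWith _∸_ α β)) (eq β)) (QP.*-zeroˡ (g (zipWith _∸_ α β))))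

⊛-zeroʳ : ∀ {n} (f : PS n) {g : PS n} → g ≗ (λ _ → 0ℚ) → ∀ α → (f ⊛ g) α ≡ 0ℚ
⊛-zeroʳ f eq α = Σ.fold-map-ε (below α) (λ β → trans (cong (f β *_) (eq (zipWith _∸_ α β))) (QP.*-zeroʳ (f β)))

⊛-[] : (f g : PS 0) → (f ⊛ g) [] ≡ f [] * g []
⊛-[] f g = QP.+-identityʳ _

δ : ℕ → ℕ → ℚ
δ a c = if does (a ℕ.≟ c) then 1ℚ else 0ℚ

mono-∷ʳ : ∀ {n} (γ : Vec ℕ n) c (α : Vec ℕ n) a → mono (γ ∷ʳ c) (α ∷ʳ a) ≡ δ a c * mono γ α
mono-∷ʳ γ c α a = indicators (VP.≡-dec ℕ._≟_ (α ∷ʳ a) (γ ∷ʳ c)) (a ℕ.≟ c) (VP.≡-dec ℕ._≟_ α γ)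
  where
  𝟙 : ∀ {P : Set} → Dec P → ℚ
  𝟙 d = if does d then 1ℚ else 0ℚ
  indicators : (d : Dec (α ∷ʳ a ≡ γ ∷ʳ c)) (e : Dec (a ≡ c)) (f : Dec (α ≡ γ)) → 𝟙 d ≡ 𝟙 e * 𝟙 f
  indicators (yes _)  (yes _)    (yes _)    = refl
  indicators (yes eq) (no a≢c)   _          = ⊥-elim (a≢c (VP.∷ʳ-injectiveʳ α γ eq))
  indicators (yes eq) (yes _)    (no α≢γ)   = ⊥-elim (α≢γ (VP.∷ʳ-injectiveˡ α γ eq))
  indicators (no neq) (yes refl) (yes refl) = ⊥-elim (neq refl)
  indicators (no _)   (yes _)    (no _)     = refl
  indicators (no _)   (no _)     f          = sym (QP.*-zeroˡ (𝟙 f))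

replicateᵥ-∷ʳ : ∀ n (x : ℕ) → V.replicate (suc n) x ≡ V.replicate n x ∷ʳ x
replicateᵥ-∷ʳ zero    x = refl
replicateᵥ-∷ʳ (suc n) x = cong (x ∷_) (replicateᵥ-∷ʳ n x)

onePS-slice : ∀ {n} a (α : Vec ℕ n) → onePS (α ∷ʳ a) ≡ δ a 0 * onePS α
onePS-slice {n} a α = trans (cong (λ v → mono v (α ∷ʳ a)) (replicateᵥ-∷ʳ n 0)) (mono-∷ʳ (V.replicate n 0) 0 α a)

tabulateᵥ-∷ʳ : ∀ {A : Set} n (f : Fin (suc n) → A) → V.tabulate f ≡ V.tabulate (f ∘ inject₁) ∷ʳ f (fromℕ n)
tabulateᵥ-∷ʳ zero    f = refl
tabulateᵥ-∷ʳ (suc n) f = cong (f Fin.zero ∷_) (tabulateᵥ-∷ʳ n (f ∘ Fin.suc))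

does-≡ : ∀ {P Q : Set} → (P → Q) → (Q → P) → (d : Dec P) (e : Dec Q) → does d ≡ does e
does-≡ f g (yes p) (yes q) = refl
does-≡ f g (yes p) (no ¬q) = ⊥-elim (¬q (f p))
does-≡ f g (no ¬p) (yes q) = ⊥-elim (¬p (g q))
does-≡ f g (no ¬p) (no ¬q) = refl

tabulateᵥ-const : ∀ {A : Set} n (x : A) → V.tabulate {n = n} (λ _ → x) ≡ V.replicate n x
tabulateᵥ-const zero    x = refl
tabulateᵥ-const (suc n) x = cong (x ∷_) (tabulateᵥ-const n x)

var-inject₁-slice : ∀ {n} (i : Fin n) a (α : Vec ℕ n) → var (inject₁ i) (α ∷ʳ a) ≡ δ a 0 * var i α
var-inject₁-slice {n} i a α = begin
  mono (V.tabulate (indicator (inject₁ i))) (α ∷ʳ a)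
    ≡⟨ cong (λ v → mono v (α ∷ʳ a)) (tabulateᵥ-∷ʳ n (indicator (inject₁ i))) ⟩
  mono (V.tabulate (indicator (inject₁ i) ∘ inject₁) ∷ʳ indicator (inject₁ i) (fromℕ n)) (α ∷ʳ a)
    ≡⟨ cong₂ (λ v c → mono (v ∷ʳ c) (α ∷ʳ a))
         (VP.tabulate-cong (λ j → cong (λ b → if b then 1 else 0)
           (does-≡ FinP.inject₁-injective (cong inject₁) (inject₁ i Fin.≟ inject₁ j) (i Fin.≟ j))))
         (cong (λ b → if b then 1 else 0) (dec-false (inject₁ i Fin.≟ fromℕ n) (FinP.fromℕ≢inject₁ ∘ sym))) ⟩
  mono (V.tabulate (indicator i) ∷ʳ 0) (α ∷ʳ a)
    ≡⟨ mono-∷ʳ _ 0 α a ⟩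
  δ a 0 * var i α ∎
  where
  open ≡-Reasoning
  indicator : ∀ {m} → Fin m → Fin m → ℕ
  indicator i j = if does (i Fin.≟ j) then 1 else 0

var-fromℕ-slice : ∀ n a (α : Vec ℕ n) → var (fromℕ n) (α ∷ʳ a) ≡ δ a 1 * onePS α
var-fromℕ-slice n a α = begin
  mono (V.tabulate indicator) (α ∷ʳ a)
    ≡⟨ cong (λ v → mono v (α ∷ʳ a)) (tabulateᵥ-∷ʳ n indicator) ⟩
  mono (V.tabulate (indicator ∘ inject₁) ∷ʳ indicator (fromℕ n)) (α ∷ʳ a)
    ≡⟨ cong₂ (λ v c → mono (v ∷ʳ c) (α ∷ʳ a))
         (trans (VP.tabulate-cong (λ j → cong (λ b → if b then 1 else 0) (dec-false (fromℕ n Fin.≟ inject₁ j) FinP.fromℕ≢inject₁)))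
                (tabulateᵥ-const n 0))
         (cong (λ b → if b then 1 else 0) (dec-true (fromℕ n Fin.≟ fromℕ n) refl)) ⟩
  mono (V.replicate n 0 ∷ʳ 1) (α ∷ʳ a)
    ≡⟨ mono-∷ʳ _ 1 α a ⟩
  δ a 1 * onePS α ∎
  where
  open ≡-Reasoning
  indicator : Fin (suc n) → ℕ
  indicator j = if does (fromℕ n Fin.≟ j) then 1 else 0

<ᵇ-true : ∀ {m n} → m < n → (m ℕ.<ᵇ n) ≡ true
<ᵇ-true {zero}  {suc n} _         = refl
<ᵇ-true {suc m} {suc n} (s≤s m<n) = <ᵇ-true m<n

<ᵇ-false : ∀ {m n} → n ≤ m → (m ℕ.<ᵇ n) ≡ false
<ᵇ-false {m}     {zero}  _         = refl
<ᵇ-false {suc m} {suc n} (s≤s n≤m) = <ᵇ-false n≤m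

linSum-slice : ∀ {n} K a (α : Vec ℕ n) →
               linSum {suc n} K (α ∷ʳ a) ≡ δ a 0 * linSum K α + (if n ℕ.<ᵇ K then δ a 1 * onePS α else 0ℚ)
linSum-slice {n} K a α = begin
  linSum K (α ∷ʳ a)
    ≡⟨ cong sumℚ (LP.map-tabulate (λ i → i) term) ⟩
  sumℚ (L.tabulate term)
    ≡⟨ Σ.tabulate-snoc n term ⟩
  sumℚ (L.tabulate (term ∘ inject₁)) + term (fromℕ n)
    ≡⟨ cong₂ _+_ inner last ⟩
  δ a 0 * linSum K α + (if n ℕ.<ᵇ K then δ a 1 * onePS α else 0ℚ) ∎
  where
  open ≡-Reasoning
  term : Fin (suc n) → ℚ
  term i = if toℕ i ℕ.<ᵇ K then var i (α ∷ʳ a) else 0ℚ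
  if-*ˡ : ∀ (b : Bool) c x → (if b then c * x else 0ℚ) ≡ c * (if b then x else 0ℚ)
  if-*ˡ true  c x = refl
  if-*ˡ false c x = sym (QP.*-zeroʳ c)
  inner : sumℚ (L.tabulate (term ∘ inject₁)) ≡ δ a 0 * linSum K α
  inner = begin
    sumℚ (L.tabulate (term ∘ inject₁))
      ≡⟨ Σ.tabulate-cong n (λ i → trans
           (cong₂ (λ t v → if t ℕ.<ᵇ K then v else 0ℚ) (FinP.toℕ-inject₁ i) (var-inject₁-slice i a α))
           (if-*ˡ (toℕ i ℕ.<ᵇ K) (δ a 0) (var i α))) ⟩
    sumℚ (L.tabulate (λ i → δ a 0 * summand i))
      ≡⟨ cong sumℚ (LP.map-tabulate (λ i → i) (λ i → δ a 0 * summand i)) ⟨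
    sumℚ (map (λ i → δ a 0 * summand i) (L.allFin n))
      ≡⟨ Σ-map-*ˡ (L.allFin n) (δ a 0) summand ⟩
    δ a 0 * linSum K α ∎
    where
    summand : Fin n → ℚ
    summand i = if toℕ i ℕ.<ᵇ K then var i α else 0ℚ
  last : term (fromℕ n) ≡ (if n ℕ.<ᵇ K then δ a 1 * onePS α else 0ℚ)
  last = cong₂ (λ t v → if t ℕ.<ᵇ K then v else 0ℚ) (FinP.toℕ-fromℕ n) (var-fromℕ-slice n a α)

linSum-slice-inner : ∀ {n} K → K ≤ n → ∀ a (α : Vec ℕ n) → linSum {suc n} K (α ∷ʳ a) ≡ δ a 0 * linSum K α
linSum-slice-inner {n} K K≤n a α = begin
  linSum K (α ∷ʳ a)
    ≡⟨ linSum-slice K a α ⟩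
  δ a 0 * linSum K α + (if n ℕ.<ᵇ K then δ a 1 * onePS α else 0ℚ)
    ≡⟨ cong (λ b → δ a 0 * linSum K α + (if b then δ a 1 * onePS α else 0ℚ)) (<ᵇ-false K≤n) ⟩
  δ a 0 * linSum K α + 0ℚ
    ≡⟨ QP.+-identityʳ _ ⟩
  δ a 0 * linSum K α ∎
  where open ≡-Reasoning

linSum-slice-last : ∀ n a (α : Vec ℕ n) → linSum {suc n} (suc n) (α ∷ʳ a) ≡ δ a 0 * linSum n α + δ a 1 * onePS α
linSum-slice-last n a α = trans (linSum-slice (suc n) a α)
  (cong₂ _+_ (cong (δ a 0 *_) linSum-all) (cong (λ b → if b then δ a 1 * onePS α else 0ℚ) (<ᵇ-true (ℕP.n<1+n n))))
  where
  linSum-all : linSum (suc n) α ≡ linSum n α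
  linSum-all = Σ.fold-map-cong (L.allFin n) (λ i → cong (λ b → if b then var i α else 0ℚ)
    (trans (<ᵇ-true (ℕP.m<n⇒m<1+n (FinP.toℕ<n i))) (sym (<ᵇ-true (FinP.toℕ<n i)))))

record Lift {n} (f : PS (suc n)) (f₀ : PS n) : Set where
  constructor lift
  field slice-lift : ∀ t α → f (α ∷ʳ t) ≡ δ t 0 * f₀ α

record AffineLift {n} (f : PS (suc n)) (f₀ f₁ : PS n) : Set where
  constructor affineLift
  field slice-affine : ∀ t α → f (α ∷ʳ t) ≡ δ t 0 * f₀ α + δ t 1 * f₁ α

onePS-lift : ∀ {n} → Lift {n} onePS onePS
onePS-lift = lift onePS-slice

∸-suc : ∀ {a t} → t < a → a ∸ t ≡ suc (a ∸ suc t)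
∸-suc = ℕP.+-∸-assoc 1

⊛-slice-liftˡ : ∀ {n} {f : PS (suc n)} {f₀ : PS n} → Lift f f₀ →
                ∀ g a α → (f ⊛ g) (α ∷ʳ a) ≡ (f₀ ⊛ slice g a) α
⊛-slice-liftˡ {f = f} {f₀} (lift f-slice) g a α = begin
  (f ⊛ g) (α ∷ʳ a)          ≡⟨ ⊛-slice f g a α ⟩
  Σ< (suc a) summand              ≡⟨ Σ.range-first a summand (λ t → ⊛-zeroˡ (slice g (a ∸ suc t)) (slice₊ t) α) ⟩
  (slice f 0 ⊛ slice g a) α ≡⟨ ⊛-congˡ (slice g a) slice₀ α ⟩
  (f₀ ⊛ slice g a) α        ∎
  where
  open ≡-Reasoning
  summand : ℕ → ℚ
  summand t = (slice f t ⊛ slice g (a ∸ t)) α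
  slice₀ : slice f 0 ≗ f₀
  slice₀ β = trans (f-slice 0 β) (QP.*-identityˡ (f₀ β))
  slice₊ : ∀ t → slice f (suc t) ≗ (λ _ → 0ℚ)
  slice₊ t β = trans (f-slice (suc t) β) (QP.*-zeroˡ (f₀ β))

⊛-slice-liftʳ : ∀ {n} {g : PS (suc n)} {g₀ : PS n} → Lift g g₀ →
                ∀ f a α → (f ⊛ g) (α ∷ʳ a) ≡ (slice f a ⊛ g₀) α
⊛-slice-liftʳ {g = g} {g₀} (lift g-slice) f a α = begin
  (f ⊛ g) (α ∷ʳ a)                ≡⟨ ⊛-slice f g a α ⟩
  Σ< (suc a) summand                    ≡⟨ Σ.range-last a summand (λ t t<a → ⊛-zeroʳ (slice f t) (slice₊ t<a) α) ⟩
  (slice f a ⊛ slice g (a ∸ a)) α ≡⟨ ⊛-congʳ (slice f a) slice₀ α ⟩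
  (slice f a ⊛ g₀) α              ∎
  where
  open ≡-Reasoning
  summand : ℕ → ℚ
  summand t = (slice f t ⊛ slice g (a ∸ t)) α
  slice₀ : slice g (a ∸ a) ≗ g₀
  slice₀ β = trans (cong (λ s → g (β ∷ʳ s)) (ℕP.n∸n≡0 a)) (trans (g-slice 0 β) (QP.*-identityˡ (g₀ β)))
  slice₊ : ∀ {t} → t < a → slice g (a ∸ t) ≗ (λ _ → 0ℚ)
  slice₊ {t} t<a β = trans (cong (λ s → g (β ∷ʳ s)) (∸-suc t<a)) (trans (g-slice (suc (a ∸ suc t)) β) (QP.*-zeroˡ (g₀ β)))

module _ {n} {f : PS (suc n)} {f₀ f₁ : PS n} (affine : AffineLift f f₀ f₁) (g : PS (suc n)) where

  private
    slice₀ : slice f 0 ≗ f₀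
    slice₀ β = trans (AffineLift.slice-affine affine 0 β) (solve 2 (λ x y → con 1ℚ :* x :+ con 0ℚ :* y := x) refl (f₀ β) (f₁ β))

    slice₁ : slice f 1 ≗ f₁
    slice₁ β = trans (AffineLift.slice-affine affine 1 β) (solve 2 (λ x y → con 0ℚ :* x :+ con 1ℚ :* y := y) refl (f₀ β) (f₁ β))

    slice₂₊ : ∀ t → slice f (suc (suc t)) ≗ (λ _ → 0ℚ)
    slice₂₊ t β = trans (AffineLift.slice-affine affine (suc (suc t)) β) (solve 2 (λ x y → con 0ℚ :* x :+ con 0ℚ :* y := con 0ℚ) refl (f₀ β) (f₁ β))

  ⊛-slice-affine-zero : ∀ α → (f ⊛ g) (α ∷ʳ 0) ≡ (f₀ ⊛ slice g 0) α
  ⊛-slice-affine-zero α = trans (⊛-slice f g 0 α) (trans (QP.+-identityʳ _) (⊛-congˡ (slice g 0) slice₀ α))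

  ⊛-slice-affine-suc : ∀ a α → (f ⊛ g) (α ∷ʳ suc a) ≡ (f₀ ⊛ slice g (suc a)) α + (f₁ ⊛ slice g a) α
  ⊛-slice-affine-suc a α = begin
    (f ⊛ g) (α ∷ʳ suc a)                      ≡⟨ ⊛-slice f g (suc a) α ⟩
    summand 0 + (summand 1 + Σ< a (λ t → summand (suc (suc t))))
      ≡⟨ cong (λ x → summand 0 + (summand 1 + x)) (Σ.range-ε-< a (λ t _ → ⊛-zeroˡ (slice g (a ∸ suc t)) (slice₂₊ t) α)) ⟩
    summand 0 + (summand 1 + 0ℚ)                          ≡⟨ cong (summand 0 +_) (QP.+-identityʳ (summand 1)) ⟩
    summand 0 + summand 1                                 ≡⟨ cong₂ _+_ (⊛-congˡ (slice g (suc a)) slice₀ α) (⊛-congˡ (slice g a) slice₁ α) ⟩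
    (f₀ ⊛ slice g (suc a)) α + (f₁ ⊛ slice g a) α ∎
    where
    open ≡-Reasoning
    summand : ℕ → ℚ
    summand t = (slice f t ⊛ slice g (suc a ∸ t)) α

⊛-identityˡ : ∀ {n} (f : PS n) → (onePS ⊛ f) ≗ f
⊛-identityˡ {zero}  f [] = trans (⊛-[] onePS f) (QP.*-identityˡ (f []))
⊛-identityˡ {suc n} f = slice-ext (λ a α → trans (⊛-slice-liftˡ onePS-lift f a α) (⊛-identityˡ (slice f a) α))

⊛-identityʳ : ∀ {n} (f : PS n) → (f ⊛ onePS) ≗ f
⊛-identityʳ {zero}  f [] = trans (⊛-[] f onePS) (QP.*-identityʳ (f []))
⊛-identityʳ {suc n} f = slice-ext (λ a α → trans (⊛-slice-liftʳ onePS-lift f a α) (⊛-identityʳ (slice f a) α))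

chq : ℕ → ℕ → ℚ
chq n k = ℕ→ℚ (n C k)

chq-pascal : ∀ n k → chq (suc n) (suc k) ≡ chq n k + chq n (suc k)
chq-pascal n k = trans (cong ℕ→ℚ (sym (nCk+nC[k+1]≡[n+1]C[k+1] n k))) (ℕ→ℚ-+ (n C k) (n C suc k))

chq-> : ∀ {n k} → n < k → chq n k ≡ 0ℚ
chq-> n<k = cong ℕ→ℚ (k>n⇒nCk≡0 n<k)

nCk*k!*[n∸k]!≡n! : ∀ {n k} → k ≤ n → (n C k) ℕ.* (k ! ℕ.* (n ∸ k) !) ≡ n !
nCk*k!*[n∸k]!≡n! {n} {k} k≤n =
  trans (cong (ℕ._* (k ! ℕ.* (n ∸ k) !)) (nCk≡n!/k![n-k]! k≤n)) (m/n*n≡m (k![n∸k]!∣n! k≤n))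
  where instance _ = k ℕP.!* (n ∸ k) !≢0

inv-!-* : ∀ {a t} → t ≤ a → inv (ℕ→ℚ (t !)) * inv (ℕ→ℚ ((a ∸ t) !)) ≡ chq a t * inv (ℕ→ℚ (a !))
inv-!-* {a} {t} t≤a = sym (≡*⇒*inv≡ A! (ℕ→ℚ-!≢0 a) (begin
  chq a t                               ≡⟨ sym (QP.*-identityʳ (chq a t)) ⟩
  chq a t * 1ℚ                          ≡⟨ cong (chq a t *_) (sym (cong₂ _*_ (*-inv T! (ℕ→ℚ-!≢0 t)) (*-inv S! (ℕ→ℚ-!≢0 (a ∸ t))))) ⟩
  chq a t * ((T! * inv T!) * (S! * inv S!))
    ≡⟨ solve 5 (λ c T! S! iT iS → c :* ((T! :* iT) :* (S! :* iS)) := (iT :* iS) :* (c :* (T! :* S!))) refl (chq a t) T! S! (inv T!) (inv S!) ⟩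
  (inv T! * inv S!) * (chq a t * (T! * S!)) ≡⟨ cong ((inv T! * inv S!) *_) C*T!*S!≡A! ⟩
  (inv T! * inv S!) * A!                    ∎))
  where
  open ≡-Reasoning
  T! = ℕ→ℚ (t !)
  S! = ℕ→ℚ ((a ∸ t) !)
  A! = ℕ→ℚ (a !)
  C*T!*S!≡A! : chq a t * (T! * S!) ≡ A!
  C*T!*S!≡A! = begin
    chq a t * (T! * S!)                       ≡⟨ cong (chq a t *_) (ℕ→ℚ-* (t !) ((a ∸ t) !)) ⟨
    chq a t * ℕ→ℚ (t ! ℕ.* (a ∸ t) !)       ≡⟨ ℕ→ℚ-* (a C t) (t ! ℕ.* (a ∸ t) !) ⟨
    ℕ→ℚ ((a C t) ℕ.* (t ! ℕ.* (a ∸ t) !))  ≡⟨ cong ℕ→ℚ (nCk*k!*[n∸k]!≡n! t≤a) ⟩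
    A!                                       ∎

falling : ℚ → ℕ → ℚ
falling x k = Π< k (λ i → x - ℕ→ℚ i)

binomℚ≡falling : ∀ x k → binomℚ x k ≡ falling x k * inv (ℕ→ℚ (k !))
binomℚ≡falling x k = cong (_* inv (ℕ→ℚ (k !))) (Π.fold-applyUpTo k (λ i → x - ℕ→ℚ i))

falling-+ : ∀ x a i → falling x (a ℕ.+ i) ≡ falling x a * falling (x - ℕ→ℚ a) i
falling-+ x a i = trans (Π.range-split a i (λ l → x - ℕ→ℚ l)) (cong (falling x a *_) (Π.range-cong i (λ l →
  trans (cong (λ y → x - y) (ℕ→ℚ-+ a l)) (solve 3 (λ x y z → x :- (y :+ z) := (x :- y) :- z) refl x (ℕ→ℚ a) (ℕ→ℚ l)))))

falling-suc : ∀ x t → falling x (suc t) ≡ x * falling (x - 1ℚ) t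
falling-suc x t = trans (falling-+ x 1 t) (cong (_* falling (x - 1ℚ) t) (solve 1 (λ x → (x :- con 0ℚ) :* con 1ℚ := x) refl x))

binomℚ-trinomial : ∀ c a i → binomℚ c (a ℕ.+ i) * chq (a ℕ.+ i) a ≡ binomℚ c a * binomℚ (c - ℕ→ℚ a) i
binomℚ-trinomial c a i = begin
  binomℚ c (a ℕ.+ i) * chq (a ℕ.+ i) a
    ≡⟨ cong (_* chq (a ℕ.+ i) a) (trans (binomℚ≡falling c (a ℕ.+ i)) (cong (_* inv (ℕ→ℚ ((a ℕ.+ i) !))) (falling-+ c a i))) ⟩
  (F * F′) * inv (ℕ→ℚ ((a ℕ.+ i) !)) * chq (a ℕ.+ i) a
    ≡⟨ solve 4 (λ x y z w → (x :* y) :* z :* w := (x :* y) :* (w :* z)) refl F F′ (inv (ℕ→ℚ ((a ℕ.+ i) !))) (chq (a ℕ.+ i) a) ⟩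
  (F * F′) * (chq (a ℕ.+ i) a * inv (ℕ→ℚ ((a ℕ.+ i) !)))
    ≡⟨ cong ((F * F′) *_) (sym (inv-!-* (ℕP.m≤m+n a i))) ⟩
  (F * F′) * (inv (ℕ→ℚ (a !)) * inv (ℕ→ℚ ((a ℕ.+ i ∸ a) !)))
    ≡⟨ cong (λ m → (F * F′) * (inv (ℕ→ℚ (a !)) * inv (ℕ→ℚ (m !)))) (ℕP.m+n∸m≡n a i) ⟩
  (F * F′) * (inv (ℕ→ℚ (a !)) * inv (ℕ→ℚ (i !)))
    ≡⟨ solve 4 (λ x y z w → (x :* y) :* (z :* w) := (x :* z) :* (y :* w)) refl F F′ (inv (ℕ→ℚ (a !))) (inv (ℕ→ℚ (i !))) ⟩
  (F * inv (ℕ→ℚ (a !))) * (F′ * inv (ℕ→ℚ (i !)))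
    ≡⟨ sym (cong₂ _*_ (binomℚ≡falling c a) (binomℚ≡falling (c - ℕ→ℚ a) i)) ⟩
  binomℚ c a * binomℚ (c - ℕ→ℚ a) i ∎
  where
  open ≡-Reasoning
  F = falling c a
  F′ = falling (c - ℕ→ℚ a) i

falling-vandermonde : ∀ a c d → Σ< (suc a) (λ t → chq a t * (falling c t * falling d (a ∸ t))) ≡ falling (c + d) a

vandermonde-shiftˡ : ∀ a c d → Σ< (suc a) (λ t → chq a t * (falling c (suc t) * falling d (a ∸ t))) ≡ c * falling (c + d - 1ℚ) a
vandermonde-shiftˡ a c d = begin
  Σ< (suc a) (λ t → chq a t * (falling c (suc t) * falling d (a ∸ t)))
    ≡⟨ Σ.range-cong (suc a) (λ t → trans (cong (λ x → chq a t * (x * falling d (a ∸ t))) (falling-suc c t))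
         (solve 4 (λ k c f h → k :* ((c :* f) :* h) := c :* (k :* (f :* h))) refl (chq a t) c (falling (c - 1ℚ) t) (falling d (a ∸ t)))) ⟩
  Σ< (suc a) (λ t → c * (chq a t * (falling (c - 1ℚ) t * falling d (a ∸ t))))
    ≡⟨ Σ<-*ˡ (suc a) c (λ t → chq a t * (falling (c - 1ℚ) t * falling d (a ∸ t))) ⟩
  c * Σ< (suc a) (λ t → chq a t * (falling (c - 1ℚ) t * falling d (a ∸ t)))
    ≡⟨ cong (c *_) (falling-vandermonde a (c - 1ℚ) d) ⟩
  c * falling ((c - 1ℚ) + d) a
    ≡⟨ cong (λ x → c * falling x a) (solve 2 (λ c d → (c :- con 1ℚ) :+ d := c :+ d :- con 1ℚ) refl c d) ⟩
  c * falling (c + d - 1ℚ) a ∎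
  where open ≡-Reasoning

vandermonde-shiftʳ : ∀ a c d → Σ< (suc (suc a)) (λ t → chq a t * (falling c t * falling d (suc a ∸ t))) ≡ d * falling (c + d - 1ℚ) a
vandermonde-shiftʳ a c d = begin
  Σ< (suc (suc a)) (λ t → chq a t * g t)
    ≡⟨ Σ.range-snoc (suc a) (λ t → chq a t * g t) ⟩
  Σ< (suc a) (λ t → chq a t * g t) + chq a (suc a) * g (suc a)
    ≡⟨ cong (Σ< (suc a) (λ t → chq a t * g t) +_) (trans (cong (_* g (suc a)) (chq-> (ℕP.n<1+n a))) (QP.*-zeroˡ (g (suc a)))) ⟩
  Σ< (suc a) (λ t → chq a t * g t) + 0ℚ
    ≡⟨ QP.+-identityʳ _ ⟩
  Σ< (suc a) (λ t → chq a t * g t)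
    ≡⟨ Σ.range-cong-< (suc a) (λ t t<1+a → trans (cong (λ m → chq a t * (falling c t * falling d m)) (ℕP.+-∸-assoc 1 (ℕP.≤-pred t<1+a)))
         (trans (cong (λ x → chq a t * (falling c t * x)) (falling-suc d (a ∸ t)))
         (solve 4 (λ k f d h → k :* (f :* (d :* h)) := d :* (k :* (f :* h))) refl (chq a t) (falling c t) d (falling (d - 1ℚ) (a ∸ t))))) ⟩
  Σ< (suc a) (λ t → d * (chq a t * (falling c t * falling (d - 1ℚ) (a ∸ t))))
    ≡⟨ Σ<-*ˡ (suc a) d (λ t → chq a t * (falling c t * falling (d - 1ℚ) (a ∸ t))) ⟩
  d * Σ< (suc a) (λ t → chq a t * (falling c t * falling (d - 1ℚ) (a ∸ t)))
    ≡⟨ cong (d *_) (falling-vandermonde a c (d - 1ℚ)) ⟩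
  d * falling (c + (d - 1ℚ)) a
    ≡⟨ cong (λ x → d * falling x a) (solve 2 (λ c d → c :+ (d :- con 1ℚ) := c :+ d :- con 1ℚ) refl c d) ⟩
  d * falling (c + d - 1ℚ) a ∎
  where
  open ≡-Reasoning
  g : ℕ → ℚ
  g t = falling c t * falling d (suc a ∸ t)

falling-vandermonde zero    c d = trans (QP.+-identityʳ _) (solve 0 (con 1ℚ :* (con 1ℚ :* con 1ℚ) := con 1ℚ) refl)
falling-vandermonde (suc a) c d = begin
  g₀ + Σ< (suc a) (λ t → chq (suc a) (suc t) * g (suc t))
    ≡⟨ cong (g₀ +_) (trans (Σ.range-cong (suc a) (λ t → trans (cong (_* g (suc t)) (chq-pascal a t)) (QP.*-distribʳ-+ (g (suc t)) (chq a t) (chq a (suc t)))))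
                            (Σ.range-distrib (suc a) (λ t → chq a t * g (suc t)) (λ t → chq a (suc t) * g (suc t)))) ⟩
  g₀ + (Σ< (suc a) (λ t → chq a t * g (suc t)) + Σ< (suc a) (λ t → chq a (suc t) * g (suc t)))
    ≡⟨ solve 3 (λ x y z → x :+ (y :+ z) := y :+ (x :+ z)) refl g₀ (Σ< (suc a) (λ t → chq a t * g (suc t))) (Σ< (suc a) (λ t → chq a (suc t) * g (suc t))) ⟩
  Σ< (suc a) (λ t → chq a t * g (suc t)) + Σ< (suc (suc a)) (λ t → chq a t * g t)
    ≡⟨ cong₂ _+_ (vandermonde-shiftˡ a c d) (vandermonde-shiftʳ a c d) ⟩
  c * falling (c + d - 1ℚ) a + d * falling (c + d - 1ℚ) a
    ≡⟨ sym (QP.*-distribʳ-+ (falling (c + d - 1ℚ) a) c d) ⟩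
  (c + d) * falling (c + d - 1ℚ) a
    ≡⟨ sym (falling-suc (c + d) a) ⟩
  falling (c + d) (suc a) ∎
  where
  open ≡-Reasoning
  g : ℕ → ℚ
  g t = falling c t * falling d (suc a ∸ t)
  g₀ = chq (suc a) 0 * g 0

binomℚ-vandermonde : ∀ c d a → Σ< (suc a) (λ t → binomℚ c t * binomℚ d (a ∸ t)) ≡ binomℚ (c + d) a
binomℚ-vandermonde c d a = begin
  Σ< (suc a) (λ t → binomℚ c t * binomℚ d (a ∸ t))
    ≡⟨ Σ.range-cong-< (suc a) (λ t t<1+a → term (ℕP.≤-pred t<1+a)) ⟩
  Σ< (suc a) (λ t → (chq a t * (falling c t * falling d (a ∸ t))) * inv (ℕ→ℚ (a !)))
    ≡⟨ Σ<-*ʳ (suc a) (inv (ℕ→ℚ (a !))) (λ t → chq a t * (falling c t * falling d (a ∸ t))) ⟩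
  Σ< (suc a) (λ t → chq a t * (falling c t * falling d (a ∸ t))) * inv (ℕ→ℚ (a !))
    ≡⟨ cong (_* inv (ℕ→ℚ (a !))) (falling-vandermonde a c d) ⟩
  falling (c + d) a * inv (ℕ→ℚ (a !))
    ≡⟨ sym (binomℚ≡falling (c + d) a) ⟩
  binomℚ (c + d) a ∎
  where
  open ≡-Reasoning
  term : ∀ {t} → t ≤ a → binomℚ c t * binomℚ d (a ∸ t) ≡ (chq a t * (falling c t * falling d (a ∸ t))) * inv (ℕ→ℚ (a !))
  term {t} t≤a = begin
    binomℚ c t * binomℚ d (a ∸ t)
      ≡⟨ cong₂ _*_ (binomℚ≡falling c t) (binomℚ≡falling d (a ∸ t)) ⟩
    (falling c t * inv (ℕ→ℚ (t !))) * (falling d (a ∸ t) * inv (ℕ→ℚ ((a ∸ t) !)))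
      ≡⟨ solve 4 (λ x y z w → (x :* z) :* (y :* w) := (x :* y) :* (z :* w)) refl (falling c t) (falling d (a ∸ t)) (inv (ℕ→ℚ (t !))) (inv (ℕ→ℚ ((a ∸ t) !))) ⟩
    (falling c t * falling d (a ∸ t)) * (inv (ℕ→ℚ (t !)) * inv (ℕ→ℚ ((a ∸ t) !)))
      ≡⟨ cong ((falling c t * falling d (a ∸ t)) *_) (inv-!-* t≤a) ⟩
    (falling c t * falling d (a ∸ t)) * (chq a t * inv (ℕ→ℚ (a !)))
      ≡⟨ solve 3 (λ x y z → x :* (y :* z) := (y :* x) :* z) refl (falling c t * falling d (a ∸ t)) (chq a t) (inv (ℕ→ℚ (a !))) ⟩
    (chq a t * (falling c t * falling d (a ∸ t))) * inv (ℕ→ℚ (a !)) ∎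

-- The factors (1 + x₁ + ⋯ + x_K)^c

linSum-lift : ∀ {n} K → K ≤ n → Lift (linSum {suc n} K) (linSum K)
linSum-lift K K≤n = lift (linSum-slice-inner K K≤n)

linSum-affineLift : ∀ n → AffineLift (linSum {suc n} (suc n)) (linSum n) onePS
linSum-affineLift n = affineLift (linSum-slice-last n)

powPS-lift : ∀ {n} {f : PS (suc n)} {f₀ : PS n} → Lift f f₀ → ∀ j → Lift (powPS f j) (powPS f₀ j)
powPS-lift         f-lift zero    = onePS-lift
powPS-lift {f = f} {f₀} f-lift (suc j) = lift (λ a α → begin
  (f ⊛ powPS f j) (α ∷ʳ a)              ≡⟨ ⊛-slice-liftˡ f-lift (powPS f j) a α ⟩
  (f₀ ⊛ slice (powPS f j) a) α           ≡⟨ ⊛-congʳ f₀ (Lift.slice-lift (powPS-lift f-lift j) a) α ⟩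
  (f₀ ⊛ (δ a 0 · powPS f₀ j)) α          ≡⟨ ⊛-scaleʳ (δ a 0) f₀ (powPS f₀ j) α ⟩
  δ a 0 * (f₀ ⊛ powPS f₀ j) α            ∎)
  where open ≡-Reasoning

-- The binomial theorem for (L + x_{n+1})^j, read off coefficientwise in x_{n+1}.
linSum-pow-slice : ∀ {n} j a (α : Vec ℕ n) →
                   powPS (linSum {suc n} (suc n)) j (α ∷ʳ a) ≡ chq j a * powPS (linSum n) (j ∸ a) α
linSum-pow-slice zero    zero    α = onePS-slice 0 α
linSum-pow-slice zero    (suc a) α = onePS-slice (suc a) α
linSum-pow-slice {n} (suc j) zero α = begin
  (L ⊛ powPS L j) (α ∷ʳ 0)          ≡⟨ ⊛-slice-affine-zero (linSum-affineLift n) (powPS L j) α ⟩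
  (L′ ⊛ slice (powPS L j) 0) α       ≡⟨ ⊛-congʳ L′ (linSum-pow-slice j 0) α ⟩
  (L′ ⊛ (chq j 0 · powPS L′ j)) α    ≡⟨ ⊛-scaleʳ (chq j 0) L′ (powPS L′ j) α ⟩
  chq j 0 * (L′ ⊛ powPS L′ j) α      ∎
  where
  open ≡-Reasoning
  L = linSum {suc n} (suc n)
  L′ = linSum {n} n
linSum-pow-slice {n} (suc j) (suc a) α = begin
  (L ⊛ powPS L j) (α ∷ʳ suc a)
    ≡⟨ ⊛-slice-affine-suc (linSum-affineLift n) (powPS L j) a α ⟩
  (L′ ⊛ slice (powPS L j) (suc a)) α + (onePS ⊛ slice (powPS L j) a) α
    ≡⟨ cong₂ _+_ (trans (⊛-congʳ L′ (linSum-pow-slice j (suc a)) α) (⊛-scaleʳ (chq j (suc a)) L′ (powPS L′ (j ∸ suc a)) α))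
                 (trans (⊛-identityˡ (slice (powPS L j) a) α) (linSum-pow-slice j a α)) ⟩
  chq j (suc a) * (L′ ⊛ powPS L′ (j ∸ suc a)) α + chq j a * powPS L′ (j ∸ a) α
    ≡⟨ cong (_+ chq j a * powPS L′ (j ∸ a) α) shift ⟩
  chq j (suc a) * powPS L′ (j ∸ a) α + chq j a * powPS L′ (j ∸ a) α
    ≡⟨ sym (QP.*-distribʳ-+ (powPS L′ (j ∸ a) α) (chq j (suc a)) (chq j a)) ⟩
  (chq j (suc a) + chq j a) * powPS L′ (j ∸ a) α
    ≡⟨ cong (_* powPS L′ (j ∸ a) α) (trans (QP.+-comm (chq j (suc a)) (chq j a)) (sym (chq-pascal j a))) ⟩
  chq (suc j) (suc a) * powPS L′ (suc j ∸ suc a) α ∎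
  where
  open ≡-Reasoning
  L = linSum {suc n} (suc n)
  L′ = linSum {n} n
  shift : chq j (suc a) * (L′ ⊛ powPS L′ (j ∸ suc a)) α ≡ chq j (suc a) * powPS L′ (j ∸ a) α
  shift with a ℕ.<? j
  ... | yes a<j = cong (λ m → chq j (suc a) * powPS L′ m α) (sym (∸-suc a<j))
  ... | no  a≮j = trans (cong (_* (L′ ⊛ powPS L′ (j ∸ suc a)) α) (chq-> j<1+a))
                  (trans (QP.*-zeroˡ ((L′ ⊛ powPS L′ (j ∸ suc a)) α))
                  (sym (trans (cong (_* powPS L′ (j ∸ a) α) (chq-> j<1+a)) (QP.*-zeroˡ (powPS L′ (j ∸ a) α)))))
    where j<1+a = s≤s (ℕP.≮⇒≥ a≮j)

linPow : ∀ {n} → ℕ → ℚ → PS n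
linPow K c = onePlusPow (linSum K) c

linPow≡Σ< : ∀ {n} K c (α : Vec ℕ n) → linPow K c α ≡ Σ< (suc (deg α)) (λ j → binomℚ c j * powPS (linSum K) j α)
linPow≡Σ< K c α = Σ.fold-map-applyUpTo (suc (deg α)) (λ j → j) (λ j → binomℚ c j * powPS (linSum K) j α)

linPow-[] : ∀ K c → linPow {0} K c [] ≡ 1ℚ
linPow-[] K c = trans (linPow≡Σ< K c []) (trans (QP.+-identityʳ _) (trans (QP.*-identityʳ _) (QP.*-identityˡ (inv 1ℚ))))

deg-∷ʳ : ∀ {n} (α : Vec ℕ n) a → deg (α ∷ʳ a) ≡ deg α ℕ.+ a
deg-∷ʳ []      a = ℕP.+-identityʳ a
deg-∷ʳ (x ∷ α) a = trans (cong (x ℕ.+_) (deg-∷ʳ α a)) (sym (ℕP.+-assoc x (deg α) a))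

linPow-lift : ∀ {n} K → K ≤ n → ∀ c → Lift (linPow {suc n} K c) (linPow K c)
linPow-lift {n} K K≤n c = lift slice-eq
  where
  open ≡-Reasoning
  pow-slice : ∀ j → Lift (powPS (linSum {suc n} K) j) (powPS (linSum K) j)
  pow-slice = powPS-lift (linSum-lift K K≤n)
  slice-eq : ∀ a α → linPow K c (α ∷ʳ a) ≡ δ a 0 * linPow K c α
  slice-eq zero α = begin
    linPow K c (α ∷ʳ 0)             ≡⟨ linPow≡Σ< K c (α ∷ʳ 0) ⟩
    Σ< (suc (deg (α ∷ʳ 0))) term    ≡⟨ cong (λ m → Σ< (suc m) term) (trans (deg-∷ʳ α 0) (ℕP.+-identityʳ (deg α))) ⟩
    Σ< (suc (deg α)) term
      ≡⟨ Σ.range-cong (suc (deg α)) (λ j → cong (binomℚ c j *_)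
           (trans (Lift.slice-lift (pow-slice j) 0 α) (QP.*-identityˡ (powPS (linSum K) j α)))) ⟩
    Σ< (suc (deg α)) (λ j → binomℚ c j * powPS (linSum K) j α)
                                    ≡⟨ linPow≡Σ< K c α ⟨
    linPow K c α                    ≡⟨ QP.*-identityˡ (linPow K c α) ⟨
    δ 0 0 * linPow K c α            ∎
    where
    term : ℕ → ℚ
    term j = binomℚ c j * powPS (linSum K) j (α ∷ʳ 0)
  slice-eq (suc a) α = begin
    linPow K c (α ∷ʳ suc a)  ≡⟨ linPow≡Σ< K c (α ∷ʳ suc a) ⟩
    Σ< (suc (deg (α ∷ʳ suc a))) (λ j → binomℚ c j * powPS (linSum K) j (α ∷ʳ suc a))
      ≡⟨ Σ.range-ε-< (suc (deg (α ∷ʳ suc a))) (λ j _ → trans (cong (binomℚ c j *_)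
           (trans (Lift.slice-lift (pow-slice j) (suc a) α) (QP.*-zeroˡ (powPS (linSum K) j α)))) (QP.*-zeroʳ (binomℚ c j))) ⟩
    0ℚ                        ≡⟨ QP.*-zeroˡ (linPow K c α) ⟨
    δ (suc a) 0 * linPow K c α ∎

linPow-slice-last : ∀ {n} c a (α : Vec ℕ n) → linPow {suc n} (suc n) c (α ∷ʳ a) ≡ binomℚ c a * linPow n (c - ℕ→ℚ a) α
linPow-slice-last {n} c a α = begin
  linPow (suc n) c (α ∷ʳ a)          ≡⟨ linPow≡Σ< (suc n) c (α ∷ʳ a) ⟩
  Σ< (suc (deg (α ∷ʳ a))) term       ≡⟨ cong (λ m → Σ< m term) deg-eq ⟩
  Σ< (a ℕ.+ suc (deg α)) term        ≡⟨ Σ.range-split a (suc (deg α)) term ⟩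
  Σ< a term + Σ< (suc (deg α)) (λ i → term (a ℕ.+ i))
    ≡⟨ cong₂ _+_ (Σ.range-ε-< a (λ j j<a → low-term j<a)) (Σ.range-cong (suc (deg α)) high-term) ⟩
  0ℚ + Σ< (suc (deg α)) (λ i → binomℚ c a * (binomℚ (c - ℕ→ℚ a) i * powPS L′ i α))
    ≡⟨ trans (QP.+-identityˡ _) (Σ<-*ˡ (suc (deg α)) (binomℚ c a) (λ i → binomℚ (c - ℕ→ℚ a) i * powPS L′ i α)) ⟩
  binomℚ c a * Σ< (suc (deg α)) (λ i → binomℚ (c - ℕ→ℚ a) i * powPS L′ i α)
    ≡⟨ cong (binomℚ c a *_) (linPow≡Σ< n (c - ℕ→ℚ a) α) ⟨
  binomℚ c a * linPow n (c - ℕ→ℚ a) α ∎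
  where
  open ≡-Reasoning
  L′ = linSum {n} n
  term : ℕ → ℚ
  term j = binomℚ c j * powPS (linSum {suc n} (suc n)) j (α ∷ʳ a)
  deg-eq : suc (deg (α ∷ʳ a)) ≡ a ℕ.+ suc (deg α)
  deg-eq = trans (cong suc (trans (deg-∷ʳ α a) (ℕP.+-comm (deg α) a))) (sym (ℕP.+-suc a (deg α)))
  low-term : ∀ {j} → j < a → term j ≡ 0ℚ
  low-term {j} j<a = begin
    binomℚ c j * powPS (linSum (suc n)) j (α ∷ʳ a) ≡⟨ cong (binomℚ c j *_) (linSum-pow-slice j a α) ⟩
    binomℚ c j * (chq j a * powPS L′ (j ∸ a) α)    ≡⟨ cong (λ x → binomℚ c j * (x * powPS L′ (j ∸ a) α)) (chq-> j<a) ⟩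
    binomℚ c j * (0ℚ * powPS L′ (j ∸ a) α)         ≡⟨ cong (binomℚ c j *_) (QP.*-zeroˡ (powPS L′ (j ∸ a) α)) ⟩
    binomℚ c j * 0ℚ                                ≡⟨ QP.*-zeroʳ (binomℚ c j) ⟩
    0ℚ                                             ∎
  high-term : ∀ i → term (a ℕ.+ i) ≡ binomℚ c a * (binomℚ (c - ℕ→ℚ a) i * powPS L′ i α)
  high-term i = begin
    binomℚ c (a ℕ.+ i) * powPS (linSum (suc n)) (a ℕ.+ i) (α ∷ʳ a)
      ≡⟨ cong (binomℚ c (a ℕ.+ i) *_) (linSum-pow-slice (a ℕ.+ i) a α) ⟩
    binomℚ c (a ℕ.+ i) * (chq (a ℕ.+ i) a * powPS L′ (a ℕ.+ i ∸ a) α)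
      ≡⟨ cong (λ m → binomℚ c (a ℕ.+ i) * (chq (a ℕ.+ i) a * powPS L′ m α)) (ℕP.m+n∸m≡n a i) ⟩
    binomℚ c (a ℕ.+ i) * (chq (a ℕ.+ i) a * powPS L′ i α)
      ≡⟨ QP.*-assoc (binomℚ c (a ℕ.+ i)) (chq (a ℕ.+ i) a) (powPS L′ i α) ⟨
    (binomℚ c (a ℕ.+ i) * chq (a ℕ.+ i) a) * powPS L′ i α
      ≡⟨ cong (_* powPS L′ i α) (binomℚ-trinomial c a i) ⟩
    (binomℚ c a * binomℚ (c - ℕ→ℚ a) i) * powPS L′ i α
      ≡⟨ QP.*-assoc (binomℚ c a) (binomℚ (c - ℕ→ℚ a) i) (powPS L′ i α) ⟩
    binomℚ c a * (binomℚ (c - ℕ→ℚ a) i * powPS L′ i α) ∎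

linPow-slice-⊛ : ∀ {n} c d t s (α : Vec ℕ n) →
                 (slice (linPow (suc n) c) t ⊛ slice (linPow (suc n) d) s) α
                 ≡ (binomℚ c t * binomℚ d s) * (linPow n (c - ℕ→ℚ t) ⊛ linPow n (d - ℕ→ℚ s)) α
linPow-slice-⊛ {n} c d t s α = begin
  (slice (linPow (suc n) c) t ⊛ slice (linPow (suc n) d) s) α
    ≡⟨ ⊛-cong (linPow-slice-last c t) (linPow-slice-last d s) α ⟩
  ((binomℚ c t · Pc) ⊛ (binomℚ d s · Pd)) α  ≡⟨ ⊛-scaleˡ (binomℚ c t) Pc (binomℚ d s · Pd) α ⟩
  binomℚ c t * (Pc ⊛ (binomℚ d s · Pd)) α    ≡⟨ cong (binomℚ c t *_) (⊛-scaleʳ (binomℚ d s) Pc Pd α) ⟩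
  binomℚ c t * (binomℚ d s * (Pc ⊛ Pd) α)    ≡⟨ QP.*-assoc (binomℚ c t) (binomℚ d s) _ ⟨
  (binomℚ c t * binomℚ d s) * (Pc ⊛ Pd) α    ∎
  where
  open ≡-Reasoning
  Pc = linPow n (c - ℕ→ℚ t)
  Pd = linPow n (d - ℕ→ℚ s)

-+-∸ : ∀ c d {a t} → t ≤ a → (c - ℕ→ℚ t) + (d - ℕ→ℚ (a ∸ t)) ≡ (c + d) - ℕ→ℚ a
-+-∸ c d {a} {t} t≤a = begin
  (c - ℕ→ℚ t) + (d - ℕ→ℚ (a ∸ t))
    ≡⟨ solve 4 (λ c d x y → (c :- x) :+ (d :- y) := (c :+ d) :- (y :+ x)) refl c d (ℕ→ℚ t) (ℕ→ℚ (a ∸ t)) ⟩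
  (c + d) - (ℕ→ℚ (a ∸ t) + ℕ→ℚ t)
    ≡⟨ cong (λ x → (c + d) - x) (trans (sym (ℕ→ℚ-+ (a ∸ t) t)) (cong ℕ→ℚ (ℕP.m∸n+n≡m t≤a))) ⟩
  (c + d) - ℕ→ℚ a ∎
  where open ≡-Reasoning

linPow-+ : ∀ n c d → (linPow {n} n c ⊛ linPow n d) ≗ linPow n (c + d)
linPow-+ zero    c d [] = trans (⊛-[] (linPow 0 c) (linPow 0 d))
                                (trans (cong₂ _*_ (linPow-[] 0 c) (linPow-[] 0 d)) (sym (linPow-[] 0 (c + d))))
linPow-+ (suc n) c d = slice-ext slice-eq
  where
  open ≡-Reasoning
  slice-eq : ∀ a α → (linPow (suc n) c ⊛ linPow (suc n) d) (α ∷ʳ a) ≡ linPow (suc n) (c + d) (α ∷ʳ a)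
  slice-eq a α = begin
    (linPow (suc n) c ⊛ linPow (suc n) d) (α ∷ʳ a)
      ≡⟨ ⊛-slice (linPow (suc n) c) (linPow (suc n) d) a α ⟩
    Σ< (suc a) (λ t → (slice (linPow (suc n) c) t ⊛ slice (linPow (suc n) d) (a ∸ t)) α)
      ≡⟨ Σ.range-cong-< (suc a) (λ t t<1+a → term (ℕP.≤-pred t<1+a)) ⟩
    Σ< (suc a) (λ t → (binomℚ c t * binomℚ d (a ∸ t)) * linPow n ((c + d) - ℕ→ℚ a) α)
      ≡⟨ Σ<-*ʳ (suc a) (linPow n ((c + d) - ℕ→ℚ a) α) (λ t → binomℚ c t * binomℚ d (a ∸ t)) ⟩
    Σ< (suc a) (λ t → binomℚ c t * binomℚ d (a ∸ t)) * linPow n ((c + d) - ℕ→ℚ a) α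
      ≡⟨ cong (_* linPow n ((c + d) - ℕ→ℚ a) α) (binomℚ-vandermonde c d a) ⟩
    binomℚ (c + d) a * linPow n ((c + d) - ℕ→ℚ a) α
      ≡⟨ linPow-slice-last (c + d) a α ⟨
    linPow (suc n) (c + d) (α ∷ʳ a) ∎
    where
    term : ∀ {t} → t ≤ a → (slice (linPow (suc n) c) t ⊛ slice (linPow (suc n) d) (a ∸ t)) α
                           ≡ (binomℚ c t * binomℚ d (a ∸ t)) * linPow n ((c + d) - ℕ→ℚ a) α
    term {t} t≤a = trans (linPow-slice-⊛ c d t (a ∸ t) α)
      (cong (binomℚ c t * binomℚ d (a ∸ t) *_)
        (trans (linPow-+ n (c - ℕ→ℚ t) (d - ℕ→ℚ (a ∸ t)) α) (cong (λ x → linPow n x α) (-+-∸ c d t≤a))))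

-- The diagonal

linPowProduct : ∀ {n} → ℕ → List ℚ → PS n → PS n
linPowProduct K []       g = g
linPowProduct K (c ∷ cs) g = linPow K c ⊛ linPowProduct (suc K) cs g

linPowProduct-cong : ∀ {n} K cs {g g′ : PS n} → g ≗ g′ → linPowProduct K cs g ≗ linPowProduct K cs g′
linPowProduct-cong K []       eq = eq
linPowProduct-cong K (c ∷ cs) eq = ⊛-congʳ (linPow K c) (linPowProduct-cong (suc K) cs eq)

linPowProduct-scale : ∀ {n} K cs x (g : PS n) → linPowProduct K cs (x · g) ≗ (x · linPowProduct K cs g)
linPowProduct-scale K []       x g α = refl
linPowProduct-scale K (c ∷ cs) x g α = trans (⊛-congʳ (linPow K c) (linPowProduct-scale (suc K) cs x g) α)
                                       (⊛-scaleʳ x (linPow K c) (linPowProduct (suc K) cs g) α)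

linPowProduct-∷ʳ : ∀ {n} K cs c (g : PS n) → linPowProduct K (cs L.∷ʳ c) g ≡ linPowProduct K cs (linPow (K ℕ.+ L.length cs) c ⊛ g)
linPowProduct-∷ʳ K []       c g = cong (λ m → linPow m c ⊛ g) (sym (ℕP.+-identityʳ K))
linPowProduct-∷ʳ K (d ∷ cs) c g = cong (linPow K d ⊛_)
  (trans (linPowProduct-∷ʳ (suc K) cs c g) (cong (λ m → linPowProduct (suc K) cs (linPow m c ⊛ g)) (sym (ℕP.+-suc K (L.length cs)))))

linPowProduct-slice : ∀ {n} K cs (g : PS (suc n)) → K ℕ.+ L.length cs ≤ suc n →
                ∀ a α → linPowProduct K cs g (α ∷ʳ a) ≡ linPowProduct K cs (slice g a) α
linPowProduct-slice K []       g _     a α = refl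
linPowProduct-slice {n} K (c ∷ cs) g bound a α = begin
  (linPow K c ⊛ linPowProduct (suc K) cs g) (α ∷ʳ a)
    ≡⟨ ⊛-slice-liftˡ (linPow-lift K K≤n c) (linPowProduct (suc K) cs g) a α ⟩
  (linPow K c ⊛ slice (linPowProduct (suc K) cs g) a) α
    ≡⟨ ⊛-congʳ (linPow K c) (linPowProduct-slice (suc K) cs g bound′ a) α ⟩
  (linPow K c ⊛ linPowProduct (suc K) cs (slice g a)) α ∎
  where
  open ≡-Reasoning
  bound′ : suc K ℕ.+ L.length cs ≤ suc n
  bound′ = ℕP.≤-trans (ℕP.≤-reflexive (sym (ℕP.+-suc K (L.length cs)))) bound
  K≤n : K ≤ n
  K≤n = ℕP.≤-pred (ℕP.≤-trans (s≤s (ℕP.m≤m+n K (L.length cs))) bound′)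

R≡linPowProduct : ∀ {N} (b : Fin N → ℚ) → R b ≡ linPowProduct 1 (L.tabulate b) onePS
R≡linPowProduct {N} b = trans (cong (L.foldr _⊛_ onePS) (LP.map-tabulate (λ k → k) (λ k → linPow (suc (toℕ k)) (b k))))
                        (foldr-tabulate N 1 b)
  where
  foldr-tabulate : ∀ M K (c : Fin M → ℚ) →
                   L.foldr _⊛_ onePS (L.tabulate (λ k → linPow (K ℕ.+ toℕ k) (c k))) ≡ linPowProduct {N} K (L.tabulate c) onePS
  foldr-tabulate zero    K c = refl
  foldr-tabulate (suc M) K c = cong₂ _⊛_ (cong (λ m → linPow m (c Fin.zero)) (ℕP.+-identityʳ K))
    (trans (cong (L.foldr _⊛_ (onePS {N})) (LP.tabulate-cong (λ k → cong (λ m → linPow m (c (Fin.suc k))) (ℕP.+-suc K (toℕ k)))))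
           (foldr-tabulate M (suc K) (c ∘ Fin.suc)))

diagProduct : List ℚ → ℕ → ℚ
diagProduct []       j = 1ℚ
diagProduct (c ∷ cs) j = binomℚ (c + sumℚ cs - ℕ→ℚ (L.length cs ℕ.* j)) j * diagProduct cs j

length-∷ʳ : ∀ {A : Set} (xs : List A) x → L.length (xs L.∷ʳ x) ≡ suc (L.length xs)
length-∷ʳ []       x = refl
length-∷ʳ (y ∷ xs) x = cong suc (length-∷ʳ xs x)

sum-∷ʳ : ∀ (xs : List ℚ) x → sumℚ (xs L.∷ʳ x) ≡ sumℚ xs + x
sum-∷ʳ xs x = trans (Σ.fold-++ xs (x ∷ [])) (cong (sumℚ xs +_) (QP.+-identityʳ x))

diagProduct-merge : ∀ (xs : List ℚ) d c j →
                    diagProduct ((xs L.∷ʳ d) L.∷ʳ c) j ≡ binomℚ c j * diagProduct (xs L.∷ʳ (d + (c - ℕ→ℚ j))) j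
diagProduct-merge [] d c j = begin
  binomℚ (d + (c + 0ℚ) - ℕ→ℚ (j ℕ.+ 0)) j * (binomℚ (c + 0ℚ - 0ℚ) j * 1ℚ)
    ≡⟨ cong₂ (λ x y → binomℚ x j * (binomℚ y j * 1ℚ)) first second ⟩
  binomℚ ((d + (c - ℕ→ℚ j)) + 0ℚ - 0ℚ) j * (binomℚ c j * 1ℚ)
    ≡⟨ solve 2 (λ x y → x :* (y :* con 1ℚ) := y :* (x :* con 1ℚ)) refl (binomℚ ((d + (c - ℕ→ℚ j)) + 0ℚ - 0ℚ) j) (binomℚ c j) ⟩
  binomℚ c j * (binomℚ ((d + (c - ℕ→ℚ j)) + 0ℚ - 0ℚ) j * 1ℚ) ∎
  where
  open ≡-Reasoning
  first : d + (c + 0ℚ) - ℕ→ℚ (j ℕ.+ 0) ≡ (d + (c - ℕ→ℚ j)) + 0ℚ - 0ℚ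
  first = trans (cong (λ m → d + (c + 0ℚ) - ℕ→ℚ m) (ℕP.+-identityʳ j))
                (solve 3 (λ d c x → d :+ (c :+ con 0ℚ) :- x := (d :+ (c :- x)) :+ con 0ℚ :- con 0ℚ) refl d c (ℕ→ℚ j))
  second : c + 0ℚ - 0ℚ ≡ c
  second = solve 1 (λ c → c :+ con 0ℚ :- con 0ℚ := c) refl c
diagProduct-merge (x ∷ xs) d c j = begin
  binomℚ (x + sumℚ ((xs L.∷ʳ d) L.∷ʳ c) - ℕ→ℚ (L.length ((xs L.∷ʳ d) L.∷ʳ c) ℕ.* j)) j * diagProduct ((xs L.∷ʳ d) L.∷ʳ c) j
    ≡⟨ cong₂ (λ u v → binomℚ u j * v) argument (diagProduct-merge xs d c j) ⟩
  binomℚ (x + sumℚ (xs L.∷ʳ e) - ℕ→ℚ (L.length (xs L.∷ʳ e) ℕ.* j)) j * (binomℚ c j * diagProduct (xs L.∷ʳ e) j)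
    ≡⟨ solve 3 (λ a b c → a :* (b :* c) := b :* (a :* c)) refl (binomℚ (x + sumℚ (xs L.∷ʳ e) - ℕ→ℚ (L.length (xs L.∷ʳ e) ℕ.* j)) j) (binomℚ c j) (diagProduct (xs L.∷ʳ e) j) ⟩
  binomℚ c j * diagProduct (x ∷ (xs L.∷ʳ e)) j ∎
  where
  open ≡-Reasoning
  e = d + (c - ℕ→ℚ j)
  ℓj = j ℕ.+ L.length xs ℕ.* j
  argument : x + sumℚ ((xs L.∷ʳ d) L.∷ʳ c) - ℕ→ℚ (L.length ((xs L.∷ʳ d) L.∷ʳ c) ℕ.* j)
           ≡ x + sumℚ (xs L.∷ʳ e) - ℕ→ℚ (L.length (xs L.∷ʳ e) ℕ.* j)
  argument = begin
    x + sumℚ ((xs L.∷ʳ d) L.∷ʳ c) - ℕ→ℚ (L.length ((xs L.∷ʳ d) L.∷ʳ c) ℕ.* j)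
      ≡⟨ cong₂ (λ s m → x + s - ℕ→ℚ (m ℕ.* j)) (trans (sum-∷ʳ (xs L.∷ʳ d) c) (cong (_+ c) (sum-∷ʳ xs d)))
                                               (trans (length-∷ʳ (xs L.∷ʳ d) c) (cong suc (length-∷ʳ xs d))) ⟩
    x + ((sumℚ xs + d) + c) - ℕ→ℚ (j ℕ.+ ℓj)
      ≡⟨ cong (λ y → x + ((sumℚ xs + d) + c) - y) (ℕ→ℚ-+ j ℓj) ⟩
    x + ((sumℚ xs + d) + c) - (ℕ→ℚ j + ℕ→ℚ ℓj)
      ≡⟨ solve 6 (λ x s d c y z → x :+ ((s :+ d) :+ c) :- (y :+ z) := x :+ (s :+ (d :+ (c :- y))) :- z) refl x (sumℚ xs) d c (ℕ→ℚ j) (ℕ→ℚ ℓj) ⟩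
    x + (sumℚ xs + e) - ℕ→ℚ ℓj
      ≡⟨ cong₂ (λ s m → x + s - ℕ→ℚ (m ℕ.* j)) (sym (sum-∷ʳ xs e)) (sym (length-∷ʳ xs e)) ⟩
    x + sumℚ (xs L.∷ʳ e) - ℕ→ℚ (L.length (xs L.∷ʳ e) ℕ.* j) ∎

linPowProduct-slice-last : ∀ n cs c → L.length cs ≡ n → ∀ a (α : Vec ℕ n) →
                     linPowProduct {suc n} 1 cs (linPow (suc n) c) (α ∷ʳ a) ≡ binomℚ c a * linPowProduct 1 cs (linPow n (c - ℕ→ℚ a)) α
linPowProduct-slice-last n cs c len a α = begin
  linPowProduct 1 cs (linPow (suc n) c) (α ∷ʳ a)               ≡⟨ linPowProduct-slice 1 cs (linPow (suc n) c) (ℕP.≤-reflexive (cong suc len)) a α ⟩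
  linPowProduct 1 cs (slice (linPow (suc n) c) a) α             ≡⟨ linPowProduct-cong 1 cs (linPow-slice-last c a) α ⟩
  linPowProduct 1 cs (binomℚ c a · linPow n (c - ℕ→ℚ a)) α      ≡⟨ linPowProduct-scale 1 cs (binomℚ c a) (linPow n (c - ℕ→ℚ a)) α ⟩
  binomℚ c a * linPowProduct 1 cs (linPow n (c - ℕ→ℚ a)) α      ∎
  where open ≡-Reasoning

linPowProduct-diag : ∀ n cs c → L.length cs ≡ n → ∀ j →
               linPowProduct {suc n} 1 cs (linPow (suc n) c) (V.replicate (suc n) j) ≡ diagProduct (cs L.∷ʳ c) j
linPowProduct-diag zero [] c refl j = begin
  linPow 1 c (V.replicate 1 j)               ≡⟨ linPowProduct-slice-last 0 [] c refl j [] ⟩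
  binomℚ c j * linPow 0 (c - ℕ→ℚ j) []      ≡⟨ cong₂ _*_ (cong (λ x → binomℚ x j) (solve 1 (λ c → c := c :+ con 0ℚ :- con 0ℚ) refl c))
                                                          (linPow-[] 0 (c - ℕ→ℚ j)) ⟩
  binomℚ (c + 0ℚ - 0ℚ) j * 1ℚ               ∎
  where open ≡-Reasoning
linPowProduct-diag (suc m) cs c len j with L.initLast cs
... | []          = ⊥-elim (ℕP.0≢1+n len)
... | cs′ L.∷ʳ′ d = begin
  linPowProduct 1 (cs′ L.∷ʳ d) (linPow (suc (suc m)) c) (V.replicate (suc (suc m)) j)
    ≡⟨ cong (linPowProduct 1 (cs′ L.∷ʳ d) (linPow (suc (suc m)) c)) (replicateᵥ-∷ʳ (suc m) j) ⟩
  linPowProduct 1 (cs′ L.∷ʳ d) (linPow (suc (suc m)) c) (v ∷ʳ j)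
    ≡⟨ linPowProduct-slice-last (suc m) (cs′ L.∷ʳ d) c len j v ⟩
  binomℚ c j * linPowProduct 1 (cs′ L.∷ʳ d) (linPow (suc m) c′) v
    ≡⟨ cong (binomℚ c j *_) merge ⟩
  binomℚ c j * linPowProduct 1 cs′ (linPow (suc m) (d + c′)) v
    ≡⟨ cong (binomℚ c j *_) (linPowProduct-diag m cs′ (d + c′) len′ j) ⟩
  binomℚ c j * diagProduct (cs′ L.∷ʳ (d + c′)) j
    ≡⟨ diagProduct-merge cs′ d c j ⟨
  diagProduct ((cs′ L.∷ʳ d) L.∷ʳ c) j ∎
  where
  open ≡-Reasoning
  v = V.replicate (suc m) j
  c′ = c - ℕ→ℚ j
  len′ : L.length cs′ ≡ m
  len′ = ℕP.suc-injective (trans (sym (length-∷ʳ cs′ d)) len)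
  merge : linPowProduct 1 (cs′ L.∷ʳ d) (linPow (suc m) c′) v ≡ linPowProduct 1 cs′ (linPow (suc m) (d + c′)) v
  merge = begin
    linPowProduct 1 (cs′ L.∷ʳ d) (linPow (suc m) c′) v
      ≡⟨ cong (λ g → g v) (linPowProduct-∷ʳ 1 cs′ d (linPow (suc m) c′)) ⟩
    linPowProduct 1 cs′ (linPow (suc (L.length cs′)) d ⊛ linPow (suc m) c′) v
      ≡⟨ cong (λ k → linPowProduct 1 cs′ (linPow (suc k) d ⊛ linPow (suc m) c′) v) len′ ⟩
    linPowProduct 1 cs′ (linPow (suc m) d ⊛ linPow (suc m) c′) v
      ≡⟨ linPowProduct-cong 1 cs′ (linPow-+ (suc m) d c′) v ⟩
    linPowProduct 1 cs′ (linPow (suc m) (d + c′)) v ∎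

tabulate-∷ʳ : ∀ {A : Set} n (f : Fin (suc n) → A) → L.tabulate f ≡ L.tabulate (f ∘ inject₁) L.∷ʳ f (fromℕ n)
tabulate-∷ʳ zero    f = refl
tabulate-∷ʳ (suc n) f = cong (f Fin.zero ∷_) (tabulate-∷ʳ n (f ∘ Fin.suc))

Diag-R : ∀ n (b : Fin (suc n) → ℚ) j → Diag (R b) j ≡ diagProduct (L.tabulate b) j
Diag-R n b j = begin
  R b v                                           ≡⟨ cong (λ f → f v) (R≡linPowProduct b) ⟩
  linPowProduct 1 (L.tabulate b) onePS v                ≡⟨ cong (λ cs → linPowProduct 1 cs onePS v) (tabulate-∷ʳ n b) ⟩
  linPowProduct 1 (cs L.∷ʳ c) onePS v                   ≡⟨ cong (λ f → f v) (linPowProduct-∷ʳ 1 cs c onePS) ⟩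
  linPowProduct 1 cs (linPow (suc (L.length cs)) c ⊛ onePS) v
    ≡⟨ linPowProduct-cong 1 cs (⊛-identityʳ (linPow (suc (L.length cs)) c)) v ⟩
  linPowProduct 1 cs (linPow (suc (L.length cs)) c) v   ≡⟨ cong (λ k → linPowProduct 1 cs (linPow (suc k) c) v) (LP.length-tabulate (b ∘ inject₁)) ⟩
  linPowProduct 1 cs (linPow (suc n) c) v               ≡⟨ linPowProduct-diag n cs c (LP.length-tabulate (b ∘ inject₁)) j ⟩
  diagProduct (cs L.∷ʳ c) j                       ≡⟨ cong (λ cs → diagProduct cs j) (tabulate-∷ʳ n b) ⟨
  diagProduct (L.tabulate b) j                    ∎
  where
  open ≡-Reasoning
  v = V.replicate (suc n) j
  cs = L.tabulate (b ∘ inject₁)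
  c = b (fromℕ n)

-- Pochhammer symbols

^ℚ-distribˡ-+-* : ∀ x a b → x ^ℚ (a ℕ.+ b) ≡ x ^ℚ a * x ^ℚ b
^ℚ-distribˡ-+-* x zero    b = sym (QP.*-identityˡ _)
^ℚ-distribˡ-+-* x (suc a) b = trans (cong (x *_) (^ℚ-distribˡ-+-* x a b)) (sym (QP.*-assoc x _ _))

^ℚ-*-assoc : ∀ x a b → (x ^ℚ a) ^ℚ b ≡ x ^ℚ (a ℕ.* b)
^ℚ-*-assoc x a zero    = cong (x ^ℚ_) (sym (ℕP.*-zeroʳ a))
^ℚ-*-assoc x a (suc b) = begin
  x ^ℚ a * (x ^ℚ a) ^ℚ b  ≡⟨ cong (x ^ℚ a *_) (^ℚ-*-assoc x a b) ⟩
  x ^ℚ a * x ^ℚ (a ℕ.* b) ≡⟨ ^ℚ-distribˡ-+-* x a (a ℕ.* b) ⟨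
  x ^ℚ (a ℕ.+ a ℕ.* b)    ≡⟨ cong (x ^ℚ_) (ℕP.*-suc a b) ⟨
  x ^ℚ (a ℕ.* suc b)      ∎
  where open ≡-Reasoning

^ℚ-distribʳ-* : ∀ x y n → (x * y) ^ℚ n ≡ x ^ℚ n * y ^ℚ n
^ℚ-distribʳ-* x y n = begin
  (x * y) ^ℚ n            ≡⟨ Π<-const n (x * y) ⟨
  Π< n (λ _ → x * y)      ≡⟨ Π.range-distrib n (λ _ → x) (λ _ → y) ⟩
  Π< n (λ _ → x) * Π< n (λ _ → y) ≡⟨ cong₂ _*_ (Π<-const n x) (Π<-const n y) ⟩
  x ^ℚ n * y ^ℚ n         ∎
  where open ≡-Reasoning

1^ℚn≡1 : ∀ n → 1ℚ ^ℚ n ≡ 1ℚ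
1^ℚn≡1 n = trans (sym (Π<-const n 1ℚ)) (Π.range-ε n)

Π<-*ʳ : ∀ m c (f : ℕ → ℚ) → Π< m (λ i → f i * c) ≡ Π< m f * c ^ℚ m
Π<-*ʳ m c f = trans (Π.range-distrib m f (λ _ → c)) (cong (Π< m f *_) (Π<-const m c))

poch-one : ∀ j → poch 1ℚ j ≡ ℕ→ℚ (j !)
poch-one zero    = refl
poch-one (suc j) = begin
  poch 1ℚ (suc j)                     ≡⟨ poch≡Π< 1ℚ (suc j) ⟩
  Π< (suc j) (λ l → 1ℚ + ℕ→ℚ l)       ≡⟨ Π.range-snoc j (λ l → 1ℚ + ℕ→ℚ l) ⟩
  Π< j (λ l → 1ℚ + ℕ→ℚ l) * (1ℚ + ℕ→ℚ j) ≡⟨ cong₂ _*_ (trans (sym (poch≡Π< 1ℚ j)) (poch-one j)) (sym (ℕ→ℚ-suc j)) ⟩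
  ℕ→ℚ (j !) * ℕ→ℚ (suc j)             ≡⟨ QP.*-comm (ℕ→ℚ (j !)) (ℕ→ℚ (suc j)) ⟩
  ℕ→ℚ (suc j) * ℕ→ℚ (j !)             ≡⟨ ℕ→ℚ-* (suc j) (j !) ⟨
  ℕ→ℚ (suc j !)                       ∎
  where open ≡-Reasoning

poch-+ : ∀ x a b → poch x (a ℕ.+ b) ≡ poch x a * poch (x + ℕ→ℚ a) b
poch-+ x a b = begin
  poch x (a ℕ.+ b)                                    ≡⟨ poch≡Π< x (a ℕ.+ b) ⟩
  Π< (a ℕ.+ b) (λ s → x + ℕ→ℚ s)                      ≡⟨ Π.range-split a b (λ s → x + ℕ→ℚ s) ⟩
  Π< a (λ s → x + ℕ→ℚ s) * Π< b (λ l → x + ℕ→ℚ (a ℕ.+ l))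
    ≡⟨ cong₂ _*_ (sym (poch≡Π< x a)) (Π.range-cong b (λ l → trans (cong (x +_) (ℕ→ℚ-+ a l)) (sym (QP.+-assoc x _ _)))) ⟩
  poch x a * Π< b (λ l → (x + ℕ→ℚ a) + ℕ→ℚ l)         ≡⟨ cong (poch x a *_) (sym (poch≡Π< (x + ℕ→ℚ a) b)) ⟩
  poch x a * poch (x + ℕ→ℚ a) b                       ∎
  where open ≡-Reasoning

binomℚ-neg : ∀ x j → binomℚ (- x) j * ℕ→ℚ (j !) ≡ (- 1ℚ) ^ℚ j * poch x j
binomℚ-neg x j = begin
  binomℚ (- x) j * F                          ≡⟨ cong (_* F) (binomℚ≡falling (- x) j) ⟩
  (falling (- x) j * inv F) * F               ≡⟨ solve 3 (λ x i F → (x :* i) :* F := x :* (F :* i)) refl (falling (- x) j) (inv F) F ⟩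
  falling (- x) j * (F * inv F)               ≡⟨ cong (falling (- x) j *_) (*-inv F (ℕ→ℚ-!≢0 j)) ⟩
  falling (- x) j * 1ℚ                        ≡⟨ QP.*-identityʳ _ ⟩
  Π< j (λ l → - x - ℕ→ℚ l)                    ≡⟨ Π.range-cong j (λ l → solve 2 (λ x l → :- x :- l := (:- con 1ℚ) :* (x :+ l)) refl x (ℕ→ℚ l)) ⟩
  Π< j (λ l → (- 1ℚ) * (x + ℕ→ℚ l))           ≡⟨ Π.range-distrib j (λ _ → - 1ℚ) (λ l → x + ℕ→ℚ l) ⟩
  Π< j (λ _ → - 1ℚ) * Π< j (λ l → x + ℕ→ℚ l)  ≡⟨ cong₂ _*_ (Π<-const j (- 1ℚ)) (sym (poch≡Π< x j)) ⟩
  (- 1ℚ) ^ℚ j * poch x j                      ∎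
  where
  open ≡-Reasoning
  F = ℕ→ℚ (j !)

poch-scaled : ∀ {M} → M ≢ 0ℚ → ∀ x j → poch (x * inv M) j * M ^ℚ j ≡ Π< j (λ l → x + M * ℕ→ℚ l)
poch-scaled {M} M≢0 x j = begin
  poch (x * inv M) j * M ^ℚ j               ≡⟨ cong (_* M ^ℚ j) (poch≡Π< (x * inv M) j) ⟩
  Π< j (λ l → x * inv M + ℕ→ℚ l) * M ^ℚ j   ≡⟨ Π<-*ʳ j M (λ l → x * inv M + ℕ→ℚ l) ⟨
  Π< j (λ l → (x * inv M + ℕ→ℚ l) * M)      ≡⟨ Π.range-cong j factor ⟩
  Π< j (λ l → x + M * ℕ→ℚ l)                ∎
  where
  open ≡-Reasoning
  factor : ∀ l → (x * inv M + ℕ→ℚ l) * M ≡ x + M * ℕ→ℚ l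
  factor l = begin
    (x * inv M + ℕ→ℚ l) * M      ≡⟨ solve 4 (λ x i l M → (x :* i :+ l) :* M := x :* (M :* i) :+ M :* l) refl x (inv M) (ℕ→ℚ l) M ⟩
    x * (M * inv M) + M * ℕ→ℚ l  ≡⟨ cong (λ u → x * u + M * ℕ→ℚ l) (*-inv M M≢0) ⟩
    x * 1ℚ + M * ℕ→ℚ l           ≡⟨ cong (_+ M * ℕ→ℚ l) (QP.*-identityʳ x) ⟩
    x + M * ℕ→ℚ l                ∎

-- Every s < m j is uniquely i + m l with i < m and l < j.
Π<-interleave : ∀ m j B → Π< m (λ i → Π< j (λ l → (B + ℕ→ℚ i) + ℕ→ℚ m * ℕ→ℚ l)) ≡ Π< (m ℕ.* j) (λ s → B + ℕ→ℚ s)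
Π<-interleave m zero    B = trans (Π.range-ε m) (cong (λ k → Π< k (λ s → B + ℕ→ℚ s)) (sym (ℕP.*-zeroʳ m)))
Π<-interleave m (suc j) B = begin
  Π< m (λ i → ((B + ℕ→ℚ i) + ℕ→ℚ m * 0ℚ) * Π< j (λ l → (B + ℕ→ℚ i) + ℕ→ℚ m * ℕ→ℚ (suc l)))
    ≡⟨ Π.range-distrib m _ _ ⟩
  Π< m (λ i → (B + ℕ→ℚ i) + ℕ→ℚ m * 0ℚ) * Π< m (λ i → Π< j (λ l → (B + ℕ→ℚ i) + ℕ→ℚ m * ℕ→ℚ (suc l)))
    ≡⟨ cong₂ _*_ (Π.range-cong m (λ i → solve 3 (λ B x M → (B :+ x) :+ M :* con 0ℚ := B :+ x) refl B (ℕ→ℚ i) (ℕ→ℚ m)))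
                 (Π.range-cong m (λ i → Π.range-cong j (λ l → shift i l))) ⟩
  Π< m (λ s → B + ℕ→ℚ s) * Π< m (λ i → Π< j (λ l → ((B + ℕ→ℚ m) + ℕ→ℚ i) + ℕ→ℚ m * ℕ→ℚ l))
    ≡⟨ cong (Π< m (λ s → B + ℕ→ℚ s) *_) (Π<-interleave m j (B + ℕ→ℚ m)) ⟩
  Π< m (λ s → B + ℕ→ℚ s) * Π< (m ℕ.* j) (λ s → (B + ℕ→ℚ m) + ℕ→ℚ s)
    ≡⟨ cong (Π< m (λ s → B + ℕ→ℚ s) *_) (Π.range-cong (m ℕ.* j) (λ s → trans (QP.+-assoc B (ℕ→ℚ m) (ℕ→ℚ s)) (cong (B +_) (sym (ℕ→ℚ-+ m s))))) ⟩
  Π< m (λ s → B + ℕ→ℚ s) * Π< (m ℕ.* j) (λ s → B + ℕ→ℚ (m ℕ.+ s))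
    ≡⟨ Π.range-split m (m ℕ.* j) (λ s → B + ℕ→ℚ s) ⟨
  Π< (m ℕ.+ m ℕ.* j) (λ s → B + ℕ→ℚ s)
    ≡⟨ cong (λ k → Π< k (λ s → B + ℕ→ℚ s)) (ℕP.*-suc m j) ⟨
  Π< (m ℕ.* suc j) (λ s → B + ℕ→ℚ s) ∎
  where
  open ≡-Reasoning
  shift : ∀ i l → (B + ℕ→ℚ i) + ℕ→ℚ m * ℕ→ℚ (suc l) ≡ ((B + ℕ→ℚ m) + ℕ→ℚ i) + ℕ→ℚ m * ℕ→ℚ l
  shift i l = trans (cong (λ y → (B + ℕ→ℚ i) + ℕ→ℚ m * y) (ℕ→ℚ-suc l))
    (solve 4 (λ B x M y → (B :+ x) :+ M :* (con 1ℚ :+ y) := ((B :+ M) :+ x) :+ M :* y) refl B (ℕ→ℚ i) (ℕ→ℚ m) (ℕ→ℚ l))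

gaussBlock : ℕ → ℚ → ℕ → ℚ
gaussBlock j B m = Π< m (λ i → poch ((B + ℕ→ℚ i) * inv (ℕ→ℚ m)) j)

-- Gauss's multiplication formula for the Pochhammer symbol.
poch-multiplication : ∀ j B m → gaussBlock j B m * (ℕ→ℚ m ^ℚ j) ^ℚ m ≡ poch B (m ℕ.* j)
poch-multiplication j B zero    = QP.*-identityˡ 1ℚ
poch-multiplication j B (suc m) = begin
  gaussBlock j B (suc m) * (M ^ℚ j) ^ℚ suc m
    ≡⟨ Π<-*ʳ (suc m) (M ^ℚ j) (λ i → poch ((B + ℕ→ℚ i) * inv M) j) ⟨
  Π< (suc m) (λ i → poch ((B + ℕ→ℚ i) * inv M) j * M ^ℚ j)
    ≡⟨ Π.range-cong (suc m) (λ i → poch-scaled (ℕ→ℚ-suc≢0 m) (B + ℕ→ℚ i) j) ⟩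
  Π< (suc m) (λ i → Π< j (λ l → (B + ℕ→ℚ i) + M * ℕ→ℚ l))
    ≡⟨ Π<-interleave (suc m) j B ⟩
  Π< (suc m ℕ.* j) (λ s → B + ℕ→ℚ s)
    ≡⟨ poch≡Π< B (suc m ℕ.* j) ⟨
  poch B (suc m ℕ.* j) ∎
  where
  open ≡-Reasoning
  M = ℕ→ℚ (suc m)

-- zPow N j is z^j for the theorem's z = (−N)^N.
zPow : ℕ → ℕ → ℚ
zPow m j = ((- ℕ→ℚ m) ^ℚ m) ^ℚ j

zPow-split : ∀ m j → zPow m j ≡ ((- 1ℚ) ^ℚ j) ^ℚ m * (ℕ→ℚ m ^ℚ j) ^ℚ m
zPow-split m j = begin
  ((- ℕ→ℚ m) ^ℚ m) ^ℚ j                    ≡⟨ ^ℚ-*-assoc (- ℕ→ℚ m) m j ⟩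
  (- ℕ→ℚ m) ^ℚ (m ℕ.* j)                  ≡⟨ cong ((- ℕ→ℚ m) ^ℚ_) (ℕP.*-comm m j) ⟩
  (- ℕ→ℚ m) ^ℚ (j ℕ.* m)                  ≡⟨ ^ℚ-*-assoc (- ℕ→ℚ m) j m ⟨
  ((- ℕ→ℚ m) ^ℚ j) ^ℚ m                    ≡⟨ cong (λ x → (x ^ℚ j) ^ℚ m) (solve 1 (λ x → :- x := (:- con 1ℚ) :* x) refl (ℕ→ℚ m)) ⟩
  (((- 1ℚ) * ℕ→ℚ m) ^ℚ j) ^ℚ m             ≡⟨ cong (_^ℚ m) (^ℚ-distribʳ-* (- 1ℚ) (ℕ→ℚ m) j) ⟩
  ((- 1ℚ) ^ℚ j * ℕ→ℚ m ^ℚ j) ^ℚ m          ≡⟨ ^ℚ-distribʳ-* ((- 1ℚ) ^ℚ j) (ℕ→ℚ m ^ℚ j) m ⟩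
  ((- 1ℚ) ^ℚ j) ^ℚ m * (ℕ→ℚ m ^ℚ j) ^ℚ m   ∎
  where open ≡-Reasoning

gaussBlock-step : ∀ j B m → binomℚ (- (B + ℕ→ℚ (m ℕ.* j))) j * ℕ→ℚ (j !) * gaussBlock j B m * zPow m j
                            ≡ gaussBlock j B (suc m) * zPow (suc m) j
gaussBlock-step j B m = begin
  binomℚ (- (B + ℕ→ℚ (m ℕ.* j))) j * ℕ→ℚ (j !) * gaussBlock j B m * zPow m j
    ≡⟨ cong₂ (λ x y → x * gaussBlock j B m * y) (binomℚ-neg (B + ℕ→ℚ (m ℕ.* j)) j) (zPow-split m j) ⟩
  σ * P * gaussBlock j B m * (σ ^ℚ m * c m)
    ≡⟨ solve 5 (λ s p u t c → s :* p :* u :* (t :* c) := (s :* t) :* ((u :* c) :* p)) refl σ P (gaussBlock j B m) (σ ^ℚ m) (c m) ⟩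
  σ ^ℚ suc m * ((gaussBlock j B m * c m) * P)
    ≡⟨ cong (λ x → σ ^ℚ suc m * (x * P)) (poch-multiplication j B m) ⟩
  σ ^ℚ suc m * (poch B (m ℕ.* j) * P)
    ≡⟨ cong (σ ^ℚ suc m *_) (poch-+ B (m ℕ.* j) j) ⟨
  σ ^ℚ suc m * poch B (m ℕ.* j ℕ.+ j)
    ≡⟨ cong (λ k → σ ^ℚ suc m * poch B k) (ℕP.+-comm (m ℕ.* j) j) ⟩
  σ ^ℚ suc m * poch B (suc m ℕ.* j)
    ≡⟨ cong (σ ^ℚ suc m *_) (poch-multiplication j B (suc m)) ⟨
  σ ^ℚ suc m * (gaussBlock j B (suc m) * c (suc m))
    ≡⟨ solve 3 (λ t u c → t :* (u :* c) := u :* (t :* c)) refl (σ ^ℚ suc m) (gaussBlock j B (suc m)) (c (suc m)) ⟩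
  gaussBlock j B (suc m) * (σ ^ℚ suc m * c (suc m))
    ≡⟨ cong (gaussBlock j B (suc m) *_) (zPow-split (suc m) j) ⟨
  gaussBlock j B (suc m) * zPow (suc m) j ∎
  where
  open ≡-Reasoning
  σ = (- 1ℚ) ^ℚ j
  P = poch (B + ℕ→ℚ (m ℕ.* j)) j
  c : ℕ → ℚ
  c k = (ℕ→ℚ k ^ℚ j) ^ℚ k

-- One block per suffix c ∷ cs′: B = −(c + Σ cs′) is the paper's B(k), and m = s + |cs′| with
-- s = 1 for the u^k and s = 0 for the v^k.
gaussBlocks : ℕ → ℕ → List ℚ → ℚ
gaussBlocks j s []       = 1ℚ
gaussBlocks j s (c ∷ cs) = gaussBlock j (- (c + sumℚ cs)) (s ℕ.+ L.length cs) * gaussBlocks j s cs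

diagProduct-telescope : ∀ j cs → diagProduct cs j * (ℕ→ℚ (j !) ^ℚ L.length cs * gaussBlocks j 0 cs)
                                 ≡ gaussBlocks j 1 cs * zPow (L.length cs) j
diagProduct-telescope j [] = begin
  1ℚ * (1ℚ * 1ℚ) ≡⟨ solve 0 (con 1ℚ :* (con 1ℚ :* con 1ℚ) := con 1ℚ :* con 1ℚ) refl ⟩
  1ℚ * 1ℚ        ≡⟨ cong (1ℚ *_) (1^ℚn≡1 j) ⟨
  1ℚ * zPow 0 j  ∎
  where open ≡-Reasoning
diagProduct-telescope j (c ∷ cs) = begin
  (β * D) * ((F * F ^ℚ ℓ) * (gaussBlock j B ℓ * V))
    ≡⟨ solve 6 (λ β D F Fℓ G V → (β :* D) :* ((F :* Fℓ) :* (G :* V)) := (β :* F :* G) :* (D :* (Fℓ :* V))) refl β D F (F ^ℚ ℓ) (gaussBlock j B ℓ) V ⟩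
  (β * F * gaussBlock j B ℓ) * (D * (F ^ℚ ℓ * V))
    ≡⟨ cong ((β * F * gaussBlock j B ℓ) *_) (diagProduct-telescope j cs) ⟩
  (β * F * gaussBlock j B ℓ) * (U * zPow ℓ j)
    ≡⟨ solve 4 (λ x G U z → (x :* G) :* (U :* z) := (x :* G :* z) :* U) refl (β * F) (gaussBlock j B ℓ) U (zPow ℓ j) ⟩
  (β * F * gaussBlock j B ℓ * zPow ℓ j) * U
    ≡⟨ cong (λ x → (binomℚ x j * F * gaussBlock j B ℓ * zPow ℓ j) * U) argument ⟩
  (binomℚ (- (B + ℕ→ℚ (ℓ ℕ.* j))) j * F * gaussBlock j B ℓ * zPow ℓ j) * U
    ≡⟨ cong (_* U) (gaussBlock-step j B ℓ) ⟩
  (gaussBlock j B (suc ℓ) * zPow (suc ℓ) j) * U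
    ≡⟨ solve 3 (λ G z U → (G :* z) :* U := (G :* U) :* z) refl (gaussBlock j B (suc ℓ)) (zPow (suc ℓ) j) U ⟩
  (gaussBlock j B (suc ℓ) * U) * zPow (suc ℓ) j ∎
  where
  open ≡-Reasoning
  ℓ = L.length cs
  B = - (c + sumℚ cs)
  β = binomℚ (c + sumℚ cs - ℕ→ℚ (ℓ ℕ.* j)) j
  D = diagProduct cs j
  F = ℕ→ℚ (j !)
  U = gaussBlocks j 1 cs
  V = gaussBlocks j 0 cs
  argument : c + sumℚ cs - ℕ→ℚ (ℓ ℕ.* j) ≡ - (B + ℕ→ℚ (ℓ ℕ.* j))
  argument = solve 2 (λ x y → x :- y := :- ((:- x) :+ y)) refl (c + sumℚ cs) (ℕ→ℚ (ℓ ℕ.* j))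

-- The hypergeometric parameters

pochProduct : ℕ → List ℚ → ℚ
pochProduct j xs = prodℚ (map (λ a → poch a j) xs)

pochProduct-≢0 : ∀ j vs → All (λ c → (i : ℕ) → c + ℕ→ℚ i ≢ 0ℚ) vs → pochProduct j vs ≢ 0ℚ
pochProduct-≢0 j []       []       ()
pochProduct-≢0 j (c ∷ vs) (c≢ ∷ vs≢) =
  *-≢0 (λ eq → Π<-≢0 j (λ l → c + ℕ→ℚ l) c≢ (trans (sym (poch≡Π< c j)) eq)) (pochProduct-≢0 j vs vs≢)

pochProduct-concatMap-allFin : ∀ j N (blocks : Fin N → List ℚ) →
                               pochProduct j (concatMap blocks (L.allFin N)) ≡ prodℚ (L.tabulate (λ k → pochProduct j (blocks k)))
pochProduct-concatMap-allFin j N blocks = trans (Π.fold-map-concatMap (λ a → poch a j) blocks (L.allFin N))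
                                                (cong prodℚ (LP.map-tabulate (λ k → k) (λ k → pochProduct j (blocks k))))

Bk-zero : ∀ {N} (b : Fin (suc N) → ℚ) → Bk b Fin.zero ≡ - (b Fin.zero + sumℚ (L.tabulate (b ∘ Fin.suc)))
Bk-zero b = cong (λ s → - (b Fin.zero + sumℚ s)) (LP.map-tabulate Fin.suc (λ i → if 0 ℕ.≤ᵇ toℕ i then b i else 0ℚ))

Bk-suc : ∀ {N} (b : Fin (suc N) → ℚ) k → Bk b (Fin.suc k) ≡ Bk (b ∘ Fin.suc) k
Bk-suc {N} b k = cong -_ (begin
  0ℚ + sumℚ (map summand (L.tabulate Fin.suc))  ≡⟨ QP.+-identityˡ _ ⟩
  sumℚ (map summand (L.tabulate Fin.suc))       ≡⟨ cong sumℚ (LP.map-tabulate Fin.suc summand) ⟩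
  sumℚ (L.tabulate (summand ∘ Fin.suc))          ≡⟨ Σ.tabulate-cong N (λ i → cong (λ x → if x then b (Fin.suc i) else 0ℚ) (≤ᵇ-suc (toℕ k) (toℕ i))) ⟩
  sumℚ (L.tabulate summand′)                     ≡⟨ cong sumℚ (LP.map-tabulate (λ i → i) summand′) ⟨
  sumℚ (map summand′ (L.allFin N))               ∎)
  where
  open ≡-Reasoning
  summand : Fin (suc N) → ℚ
  summand i = if toℕ (Fin.suc k) ℕ.≤ᵇ toℕ i then b i else 0ℚ
  summand′ : Fin N → ℚ
  summand′ i = if toℕ k ℕ.≤ᵇ toℕ i then b (Fin.suc i) else 0ℚ
  ≤ᵇ-suc : ∀ t u → (suc t ℕ.≤ᵇ suc u) ≡ (t ℕ.≤ᵇ u)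
  ≤ᵇ-suc zero    u = refl
  ≤ᵇ-suc (suc t) u = refl

gaussBlocks-tabulate : ∀ j s N (b : Fin N → ℚ) →
                       prodℚ (L.tabulate (λ k → gaussBlock j (Bk b k) (s ℕ.+ (N ∸ suc (toℕ k))))) ≡ gaussBlocks j s (L.tabulate b)
gaussBlocks-tabulate j s zero    b = refl
gaussBlocks-tabulate j s (suc N) b = cong₂ _*_
  (cong₂ (gaussBlock j) (Bk-zero b) (cong (s ℕ.+_) (sym (LP.length-tabulate (b ∘ Fin.suc)))))
  (trans (Π.tabulate-cong N (λ k → cong (λ B → gaussBlock j B (s ℕ.+ (N ∸ suc (toℕ k)))) (Bk-suc b k)))
         (gaussBlocks-tabulate j s N (b ∘ Fin.suc)))

pochProduct-uParams : ∀ j {N} (b : Fin N → ℚ) → pochProduct j (uParams b) ≡ gaussBlocks j 1 (L.tabulate b)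
pochProduct-uParams j {N} b = begin
  pochProduct j (uParams b)
    ≡⟨ pochProduct-concatMap-allFin j N (uPart b) ⟩
  prodℚ (L.tabulate (λ k → pochProduct j (uPart b k)))
    ≡⟨ Π.tabulate-cong N block ⟩
  prodℚ (L.tabulate (λ k → gaussBlock j (Bk b k) (1 ℕ.+ (N ∸ suc (toℕ k)))))
    ≡⟨ gaussBlocks-tabulate j 1 N b ⟩
  gaussBlocks j 1 (L.tabulate b) ∎
  where
  open ≡-Reasoning
  block : ∀ k → pochProduct j (uPart b k) ≡ gaussBlock j (Bk b k) (1 ℕ.+ (N ∸ suc (toℕ k)))
  block k = trans (Π.fold-map-applyUpTo (N ∸ toℕ k) _ (λ a → poch a j))
                  (cong (gaussBlock j (Bk b k)) (∸-suc (FinP.toℕ<n k)))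

prodℚ-replicate : ∀ m x → prodℚ (L.replicate m x) ≡ x ^ℚ m
prodℚ-replicate zero    x = refl
prodℚ-replicate (suc m) x = cong (x *_) (prodℚ-replicate m x)

-- The N − 1 ones of v^N contribute (1)_j^{N−1} = j!^{N−1}; every other v^k is a Gauss block.
pochProduct-vPart : ∀ j {N} (b : Fin N → ℚ) k →
              pochProduct j (vPart b k) ≡ (if suc (toℕ k) ℕ.≡ᵇ N then ℕ→ℚ (j !) ^ℚ (N ∸ 1) else 1ℚ) * gaussBlock j (Bk b k) (N ∸ suc (toℕ k))
pochProduct-vPart j {N} b k with suc (toℕ k) ℕ.≡ᵇ N in last
... | true  = begin
  prodℚ (map (λ a → poch a j) (L.replicate (N ∸ 1) 1ℚ)) ≡⟨ cong prodℚ (LP.map-replicate (λ a → poch a j) (N ∸ 1) 1ℚ) ⟩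
  prodℚ (L.replicate (N ∸ 1) (poch 1ℚ j))              ≡⟨ prodℚ-replicate (N ∸ 1) (poch 1ℚ j) ⟩
  poch 1ℚ j ^ℚ (N ∸ 1)                                 ≡⟨ cong (_^ℚ (N ∸ 1)) (poch-one j) ⟩
  ℕ→ℚ (j !) ^ℚ (N ∸ 1)                                 ≡⟨ QP.*-identityʳ _ ⟨
  ℕ→ℚ (j !) ^ℚ (N ∸ 1) * gaussBlock j (Bk b k) 0       ≡⟨ cong (λ m → ℕ→ℚ (j !) ^ℚ (N ∸ 1) * gaussBlock j (Bk b k) m) N∸N≡0 ⟨
  ℕ→ℚ (j !) ^ℚ (N ∸ 1) * gaussBlock j (Bk b k) (N ∸ suc (toℕ k)) ∎
  where
  open ≡-Reasoning
  N∸N≡0 : N ∸ suc (toℕ k) ≡ 0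
  N∸N≡0 = trans (cong (N ∸_) (ℕP.≡ᵇ⇒≡ (suc (toℕ k)) N (subst T (sym last) _))) (ℕP.n∸n≡0 N)
... | false = trans (Π.fold-map-applyUpTo (N ∸ suc (toℕ k)) _ (λ a → poch a j)) (sym (QP.*-identityˡ _))

prod-tabulate-last : ∀ x n → prodℚ (L.tabulate (λ (k : Fin (suc n)) → if suc (toℕ k) ℕ.≡ᵇ suc n then x else 1ℚ)) ≡ x
prod-tabulate-last x n = begin
  prodℚ (L.tabulate factor)                              ≡⟨ Π.tabulate-snoc n factor ⟩
  prodℚ (L.tabulate (factor ∘ inject₁)) * factor (fromℕ n) ≡⟨ cong₂ _*_ inner last ⟩
  1ℚ * x                                                 ≡⟨ QP.*-identityˡ x ⟩
  x                                                      ∎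
  where
  open ≡-Reasoning
  factor : Fin (suc n) → ℚ
  factor k = if suc (toℕ k) ℕ.≡ᵇ suc n then x else 1ℚ
  inner : prodℚ (L.tabulate (factor ∘ inject₁)) ≡ 1ℚ
  inner = trans (Π.tabulate-cong n (λ i → cong (λ c → if c then x else 1ℚ)
                  (dec-false (toℕ (inject₁ i) ℕ.≟ n) (λ eq → ℕP.<-irrefl (trans (sym (FinP.toℕ-inject₁ i)) eq) (FinP.toℕ<n i)))))
                (Π.tabulate-ε n)
  last : factor (fromℕ n) ≡ x
  last = cong (λ c → if c then x else 1ℚ) (dec-true (toℕ (fromℕ n) ℕ.≟ n) (FinP.toℕ-fromℕ n))

pochProduct-vParams : ∀ j n (b : Fin (suc n) → ℚ) → pochProduct j (vParams b) ≡ ℕ→ℚ (j !) ^ℚ n * gaussBlocks j 0 (L.tabulate b)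
pochProduct-vParams j n b = begin
  pochProduct j (vParams b)
    ≡⟨ pochProduct-concatMap-allFin j (suc n) (vPart b) ⟩
  prodℚ (L.tabulate (λ k → pochProduct j (vPart b k)))
    ≡⟨ Π.tabulate-cong (suc n) (pochProduct-vPart j b) ⟩
  prodℚ (L.tabulate (λ k → ones k * gaussBlock j (Bk b k) (suc n ∸ suc (toℕ k))))
    ≡⟨ Π.tabulate-distrib (suc n) ones (λ k → gaussBlock j (Bk b k) (suc n ∸ suc (toℕ k))) ⟩
  prodℚ (L.tabulate ones) * prodℚ (L.tabulate (λ k → gaussBlock j (Bk b k) (suc n ∸ suc (toℕ k))))
    ≡⟨ cong₂ _*_ (prod-tabulate-last (ℕ→ℚ (j !) ^ℚ n) n) (gaussBlocks-tabulate j 0 (suc n) b) ⟩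
  ℕ→ℚ (j !) ^ℚ n * gaussBlocks j 0 (L.tabulate b) ∎
  where
  open ≡-Reasoning
  ones : Fin (suc n) → ℚ
  ones k = if suc (toℕ k) ℕ.≡ᵇ suc n then ℕ→ℚ (j !) ^ℚ n else 1ℚ

pochProducts-telescope : ∀ j n (b : Fin (suc n) → ℚ) →
  pochProduct j (uParams b) * zPow (suc n) j ≡ diagProduct (L.tabulate b) j * (pochProduct j (vParams b) * ℕ→ℚ (j !))
pochProducts-telescope j n b = begin
  pochProduct j (uParams b) * zPow (suc n) j
    ≡⟨ cong (_* zPow (suc n) j) (pochProduct-uParams j b) ⟩
  gaussBlocks j 1 cs * zPow (suc n) j
    ≡⟨ cong (λ m → gaussBlocks j 1 cs * zPow m j) (LP.length-tabulate b) ⟨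
  gaussBlocks j 1 cs * zPow (L.length cs) j
    ≡⟨ diagProduct-telescope j cs ⟨
  D * (F ^ℚ L.length cs * gaussBlocks j 0 cs)
    ≡⟨ cong (λ m → D * (F ^ℚ m * gaussBlocks j 0 cs)) (LP.length-tabulate b) ⟩
  D * ((F * F ^ℚ n) * gaussBlocks j 0 cs)
    ≡⟨ solve 4 (λ D F Fn V → D :* ((F :* Fn) :* V) := D :* ((Fn :* V) :* F)) refl D F (F ^ℚ n) (gaussBlocks j 0 cs) ⟩
  D * ((F ^ℚ n * gaussBlocks j 0 cs) * F)
    ≡⟨ cong (λ v → D * (v * F)) (pochProduct-vParams j n b) ⟨
  D * (pochProduct j (vParams b) * F) ∎
  where
  open ≡-Reasoning
  cs = L.tabulate b
  D = diagProduct cs j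
  F = ℕ→ℚ (j !)

theorem3 : (n : ℕ) (b : Fin (suc n) → ℚ) →
    b (fromℕ n) ≢ 0ℚ →
    All (λ c → (j : ℕ) → c + ℕ→ℚ j ≢ 0ℚ) (vParams b) →
    (j : ℕ) →
    Diag (R b) j ≡ hypF (uParams b) (vParams b) ((- ℕ→ℚ (suc n)) ^ℚ suc n) j
theorem3 n b _ v≢-ℕ j = begin
  Diag (R b) j                 ≡⟨ Diag-R n b j ⟩
  diagProduct (L.tabulate b) j ≡⟨ ≡*⇒*inv≡ (V * F) V*F≢0 (pochProducts-telescope j n b) ⟨
  (U * zPow (suc n) j) * inv (V * F)
    ≡⟨ solve 3 (λ u z i → (u :* z) :* i := u :* i :* z) refl U (zPow (suc n) j) (inv (V * F)) ⟩
  U * inv (V * F) * zPow (suc n) j ∎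
  where
  open ≡-Reasoning
  U = pochProduct j (uParams b)
  V = pochProduct j (vParams b)
  F = ℕ→ℚ (j !)
  V*F≢0 : V * F ≢ 0ℚ
  V*F≢0 = *-≢0 (pochProduct-≢0 j (vParams b) v≢-ℕ) (ℕ→ℚ-!≢0 j)
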